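{- Let $D$ be an internally connected triangulated disk with more than one internal vertex. Then $D$ has an edge joining two internal vertices that is contractible, i.e. lies in no missing triangle of $D$.
   Context: A triangulated disk is a simplicial complex whose realization is a closed disk. Its boundary vertices are those on the boundary circle; the others are internal. $D$ is internally connected if the induced subcomplex on its internal vertices is connected. A missing triangle in $D$ is a triple $a,b,c$ of vertices such that $ab,ac,bc$ are edges of $D$ but $abc$ is not a 2-face of $D$. -}

module Defs where

open import Data.Nat using (ℕ; _+_)
open import Data.Fin using (Fin; _<_; _<?_)
open import Data.Fin.Properties using (any?) renaming (_≟_ to _≟ᶠ_)
open import Data.Product using (Σ; ∃; ∃-syntax; _×_; _,_; proj₁; proj₂)
open import Data.Product.Properties using (≡-dec)
open import Data.Sum using (_⊎_)
open import Data.List using (List; length; filter; allFin; cartesianProduct)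
open import Data.List.Membership.Propositional using (_∈_)
open import Data.List.Membership.DecPropositional using () renaming (_∈?_ to mem?)
open import Data.List.Relation.Unary.All using (All)
open import Data.List.Relation.Unary.Unique.Propositional using (Unique)
open import Relation.Binary.PropositionalEquality using (_≡_; _≢_)
open import Relation.Binary.Construct.Closure.ReflexiveTransitive using (Star)
open import Relation.Nullary using (¬_; Dec)
open import Relation.Nullary.Decidable using (_⊎-dec_; _×-dec_)

-- A (pure, 2-dimensional) simplicial complex on the vertex set Fin n is
-- given by the list of its triangles (2-faces), each written as an
-- increasing triple (a , b , c) with a < b < c.  Edges and vertices are
-- the faces of the triangles (a triangulated disk is pure).
Triple : ℕ → Set
Triple n = Fin n × Fin n × Fin n

module _ {n : ℕ} (fs : List (Triple n)) where

  Face : Fin n → Fin n → Fin n → Set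
  Face x y z = (x , y , z) ∈ fs ⊎ (x , z , y) ∈ fs ⊎ (y , x , z) ∈ fs
             ⊎ (y , z , x) ∈ fs ⊎ (z , x , y) ∈ fs ⊎ (z , y , x) ∈ fs

  Edge : Fin n → Fin n → Set
  Edge x y = ∃[ z ] Face x y z

  BoundaryEdge : Fin n → Fin n → Set
  BoundaryEdge x y = Σ (Fin n) λ z → Face x y z × (∀ w → Face x y w → w ≡ z)

  BoundaryVertex : Fin n → Set
  BoundaryVertex v = ∃[ u ] BoundaryEdge v u

  InternalVertex : Fin n → Set
  InternalVertex v = ¬ BoundaryVertex v

  MissingTriangle : Fin n → Fin n → Fin n → Set
  MissingTriangle a b c = Edge a b × Edge a c × Edge b c × ¬ Face a b c

  Contractible : Fin n → Fin n → Set
  Contractible a b = Edge a b × (∀ c → ¬ MissingTriangle a b c)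

  face? : ∀ x y z → Dec (Face x y z)
  face? x y z = m (x , y , z) ⊎-dec m (x , z , y) ⊎-dec m (y , x , z)
      ⊎-dec m (y , z , x) ⊎-dec m (z , x , y) ⊎-dec m (z , y , x)
    where
      m : ∀ t → Dec (t ∈ fs)
      m t = mem? (≡-dec _≟ᶠ_ (≡-dec _≟ᶠ_ _≟ᶠ_)) t fs

  edgeList : List (Fin n × Fin n)
  edgeList = filter (λ p → (proj₁ p <? proj₂ p) ×-dec any? (face? (proj₁ p) (proj₂ p)))
                    (cartesianProduct (allFin n) (allFin n))

  record TriangulatedDisk : Set where
    field
      sorted    : All (λ t → proj₁ t < proj₁ (proj₂ t) × proj₁ (proj₂ t) < proj₂ (proj₂ t)) fs
      distinct  : Unique fs
      covering  : ∀ v → ∃[ y ] Edge v y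
      edgeDeg≤2 : ∀ x y z w u → Face x y z → Face x y w → Face x y u
                  → z ≡ w ⊎ z ≡ u ⊎ w ≡ u
      linkConn  : ∀ v x y → Edge v x → Edge v y → Star (Face v) x y
      connected : ∀ x y → Star Edge x y
      boundary  : ∃[ x ] ∃[ y ] BoundaryEdge x y
      euler     : n + length fs ≡ 1 + length edgeList

  InternallyConnected : Set
  InternallyConnected = ∀ x y → InternalVertex x → InternalVertex y →
    Star (λ a b → Edge a b × InternalVertex a × InternalVertex b) x y

{-# OPTIONS --safe #-}
module Submission where

-- Work with chains over ℤ/2.  In a triangulated disk every 1-cycle is the boundary
-- of exactly one 2-chain.  Uniqueness: a nonzero 2-cycle spreads through the
-- (connected) links and along the (connected) 1-skeleton up to the face at a
-- boundary edge, where its boundary cannot vanish.  Existence: collapse free faces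
-- and prune pendant edges, keeping E + 1 ≤ V + F (initially the Euler relation);
-- when no face is free the remaining faces form a 2-cycle, hence there are none,
-- and then a connected graph without pendant edges would have E ≥ V.
--
-- So a missing triangle abc bounds a unique 2-chain R.  If a is internal, the face
-- abd of R on the edge ab has d ∉ abc, so ∂R vanishes around d: R contains the whole
-- star of d, and d is internal since a boundary edge at d would lie in ∂R.  If ad is
-- not contractible, it lies in a missing triangle ade, whose chain R′ satisfies
-- R′ ⊊ R.  Induction on the number of faces of R ends at an internal contractible edge.

open import Defs

open import Algebra.Bundles using (CommutativeRing; CommutativeMonoid)
import Algebra.Properties.CommutativeSemigroup as CommutativeSemigroupProperties
open import Data.Bool using (Bool; true; false; not; _∧_; _∨_; _xor_)
open import Data.Bool.Properties
  renaming (_≟_ to _≟ᵇ_)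
  using ( ¬-not; ∨-zeroʳ; ∧-zeroʳ; ∧-identityʳ; ∧-distribʳ-xor
        ; xor-same; xor-assoc; xor-comm; xor-identityʳ; xor-∧-commutativeRing; ∨-commutativeMonoid)
open import Data.Empty using (⊥-elim)
open import Data.Fin using (Fin)
import Data.Fin as Fin
open import Data.Fin.Properties using (_≟_; <-cmp; <-asym; <-trans; <⇒≢; ≤-antisym; any?; all?; ¬∀⟶∃¬)
open import Data.List using (List; []; _∷_; _++_; map; length; filter; allFin; cartesianProduct)
open import Data.List.Properties using (length-tabulate)
open import Data.List.Membership.Propositional using (_∈_)
open import Data.List.Membership.Propositional.Properties using (∈-allFin; ∈-cartesianProduct⁺)
open import Data.List.Relation.Unary.All using (lookup)
open import Data.List.Relation.Unary.AllPairs using (_∷_)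
open import Data.List.Relation.Unary.Any using (here; there)
open import Data.List.Relation.Unary.Unique.Propositional using (Unique)
open import Data.List.Relation.Unary.Unique.Propositional.Properties using (allFin⁺; cartesianProduct⁺)
open import Data.Nat using (ℕ; suc; _+_; _≤_; _<_; z≤n; s≤s)
open import Data.Nat.Induction using (<-wellFounded)
import Data.Nat.Properties as ℕ
open import Data.Product using (Σ; ∃; _×_; _,_; proj₁; proj₂)
open import Data.Product.Properties using (≡-dec)
open import Data.Sum using (_⊎_; inj₁; inj₂; [_,_]′)
open import Function using (case_of_; _∘_; id)
open import Function.Bundles using (mk⇔)
open import Induction.WellFounded using (Acc; acc)
open import Relation.Binary.Construct.Closure.ReflexiveTransitive using (Star; ε; _◅_)
import Relation.Binary.Construct.Closure.ReflexiveTransitive as Star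
open import Relation.Binary.Definitions using (DecidableEquality; tri<; tri≈; tri>)
open import Relation.Binary.PropositionalEquality
  using (_≡_; _≢_; ≢-sym; refl; sym; trans; cong; cong₂; subst; module ≡-Reasoning)
open import Relation.Nullary using (¬_; Dec; yes; no; does)
open import Relation.Nullary.Decidable
  using (dec-true; dec-false; does-⇔; _×-dec_; _⊎-dec_; _→-dec_; ¬?; decidable-stable)

private
  module ⊕ = CommutativeSemigroupProperties (CommutativeRing.+-commutativeSemigroup xor-∧-commutativeRing)
  module ∨ = CommutativeSemigroupProperties (CommutativeMonoid.commutativeSemigroup ∨-commutativeMonoid)
  module ℕ+ = CommutativeSemigroupProperties ℕ.+-commutativeSemigroup

true≢false : true ≢ false
true≢false ()

∧≡true : ∀ a {b} → a ∧ b ≡ true → a ≡ true × b ≡ true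
∧≡true true b≡true = refl , b≡true

not≡true : ∀ {a} → not a ≡ true → a ≡ false
not≡true {false} _ = refl

xor≡false⇒≡ : ∀ {a b} → a xor b ≡ false → a ≡ b
xor≡false⇒≡ {false} b≡false = sym b≡false
xor≡false⇒≡ {true}  {true} _ = refl

⟦_⟧ : Bool → ℕ
⟦ true ⟧  = 1
⟦ false ⟧ = 0

module _ {A : Set} where

  sumOver : (A → ℕ) → List A → ℕ
  sumOver f []       = 0
  sumOver f (x ∷ xs) = f x + sumOver f xs

  count : (A → Bool) → List A → ℕ
  count P = sumOver (λ x → ⟦ P x ⟧)

  parity : (A → Bool) → List A → Bool
  parity P []       = false
  parity P (x ∷ xs) = P x xor parity P xs

  sumOver-cong : ∀ {f g : A → ℕ} xs → (∀ x → x ∈ xs → f x ≡ g x) → sumOver f xs ≡ sumOver g xs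
  sumOver-cong []       f≗g = refl
  sumOver-cong (x ∷ xs) f≗g =
    cong₂ _+_ (f≗g x (here refl)) (sumOver-cong xs (λ y y∈xs → f≗g y (there y∈xs)))

  sumOver-+ : ∀ (f g : A → ℕ) xs → sumOver (λ x → f x + g x) xs ≡ sumOver f xs + sumOver g xs
  sumOver-+ f g []       = refl
  sumOver-+ f g (x ∷ xs) =
    trans (cong (f x + g x +_) (sumOver-+ f g xs)) (ℕ+.interchange (f x) (g x) _ _)

  sumOver-++ : ∀ (f : A → ℕ) xs ys → sumOver f (xs ++ ys) ≡ sumOver f xs + sumOver f ys
  sumOver-++ f []       ys = refl
  sumOver-++ f (x ∷ xs) ys = trans (cong (f x +_) (sumOver-++ f xs ys)) (sym (ℕ.+-assoc (f x) _ _))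

  count-cong : ∀ {P Q : A → Bool} xs → (∀ x → x ∈ xs → P x ≡ Q x) → count P xs ≡ count Q xs
  count-cong xs P≗Q = sumOver-cong xs (λ x x∈xs → cong ⟦_⟧ (P≗Q x x∈xs))

  count-zero : ∀ {P : A → Bool} xs → (∀ x → x ∈ xs → P x ≡ false) → count P xs ≡ 0
  count-zero []       P≗false = refl
  count-zero (x ∷ xs) P≗false rewrite P≗false x (here refl) =
    count-zero xs (λ y y∈xs → P≗false y (there y∈xs))

  count-true : ∀ xs → count (λ _ → true) xs ≡ length xs
  count-true []       = refl
  count-true (x ∷ xs) = cong suc (count-true xs)

  length-filter≡count : ∀ {P : A → Set} (P? : ∀ x → Dec (P x)) xs →
                        length (filter P? xs) ≡ count (λ x → does (P? x)) xs
  length-filter≡count P? []       = refl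
  length-filter≡count P? (x ∷ xs) with does (P? x)
  ... | true  = cong suc (length-filter≡count P? xs)
  ... | false = length-filter≡count P? xs

  count-suc-at : ∀ {P Q : A → Bool} {q} xs → Unique xs → q ∈ xs → P q ≡ true → Q q ≡ false →
                 (∀ x → x ∈ xs → x ≢ q → P x ≡ Q x) → count P xs ≡ suc (count Q xs)
  count-suc-at (x ∷ xs) (x∉xs ∷ _) (here refl) Pq Qq P≗Q rewrite Pq | Qq =
    cong suc (count-cong xs (λ y y∈xs → P≗Q y (there y∈xs) (≢-sym (lookup x∉xs y∈xs))))
  count-suc-at {Q = Q} (x ∷ xs) (x∉xs ∷ unique) (there q∈xs) Pq Qq P≗Q
    rewrite P≗Q x (here refl) (lookup x∉xs q∈xs) =
    trans (cong (⟦ Q x ⟧ +_) (count-suc-at xs unique q∈xs Pq Qq (λ y y∈xs → P≗Q y (there y∈xs))))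
          (ℕ.+-suc ⟦ Q x ⟧ (count Q xs))

  count-<-or-agree : ∀ {P Q : A → Bool} xs → (∀ x → x ∈ xs → P x ≡ true → Q x ≡ true) →
                     count P xs < count Q xs ⊎ (∀ x → x ∈ xs → P x ≡ Q x)
  count-<-or-agree []       P⇒Q = inj₂ (λ _ ())
  count-<-or-agree {P} {Q} (x ∷ xs) P⇒Q
    with P x in Px | Q x in Qx | count-<-or-agree xs (λ y y∈xs → P⇒Q y (there y∈xs))
  ... | true  | false | _ with () ← trans (sym (P⇒Q x (here refl) Px)) Qx
  ... | true  | true  | inj₁ lt = inj₁ (s≤s lt)
  ... | false | false | inj₁ lt = inj₁ lt
  ... | false | true  | inj₁ lt = inj₁ (ℕ.≤-trans lt (ℕ.n≤1+n _))
  ... | true  | true  | inj₂ eq = inj₂ λ { y (here refl) → trans Px (sym Qx) ; y (there y∈xs) → eq y y∈xs }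
  ... | false | false | inj₂ eq = inj₂ λ { y (here refl) → trans Px (sym Qx) ; y (there y∈xs) → eq y y∈xs }
  ... | false | true  | inj₂ eq = inj₁ (s≤s (ℕ.≤-reflexive (count-cong xs eq)))

  count+count≤sumOver : ∀ {P : A → Bool} {f : A → ℕ} xs → (∀ x → P x ≡ true → 2 ≤ f x) →
                        count P xs + count P xs ≤ sumOver f xs
  count+count≤sumOver []                 P⇒2≤f = z≤n
  count+count≤sumOver {P} {f} (x ∷ xs) P⇒2≤f with P x in Px
  ... | true  = subst (_≤ f x + sumOver f xs) (sym (cong suc (ℕ.+-suc (count P xs) (count P xs))))
                      (ℕ.+-mono-≤ (P⇒2≤f x Px) (count+count≤sumOver xs P⇒2≤f))
  ... | false = ℕ.≤-trans (count+count≤sumOver xs P⇒2≤f) (ℕ.m≤n+m _ (f x))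

  1≤count : ∀ {P : A → Bool} {q} xs → q ∈ xs → P q ≡ true → 1 ≤ count P xs
  1≤count (x ∷ xs) (here refl) Pq rewrite Pq = s≤s z≤n
  1≤count {P} (x ∷ xs) (there q∈xs) Pq = ℕ.≤-trans (1≤count xs q∈xs Pq) (ℕ.m≤n+m _ ⟦ P x ⟧)

  2≤count : ∀ {P : A → Bool} {p q} xs → Unique xs → p ∈ xs → q ∈ xs → p ≢ q →
            P p ≡ true → P q ≡ true → 2 ≤ count P xs
  2≤count (x ∷ xs) _ (here refl) (here refl)  p≢q _ _ = ⊥-elim (p≢q refl)
  2≤count (x ∷ xs) _ (here refl) (there q∈xs) _ Pp Pq rewrite Pp = s≤s (1≤count xs q∈xs Pq)
  2≤count (x ∷ xs) _ (there p∈xs) (here refl) _ Pp Pq rewrite Pq = s≤s (1≤count xs p∈xs Pp)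
  2≤count {P} (x ∷ xs) (_ ∷ unique) (there p∈xs) (there q∈xs) p≢q Pp Pq =
    ℕ.≤-trans (2≤count xs unique p∈xs q∈xs p≢q Pp Pq) (ℕ.m≤n+m _ ⟦ P x ⟧)

  parity-cong : ∀ {P Q : A → Bool} xs → (∀ x → x ∈ xs → P x ≡ Q x) → parity P xs ≡ parity Q xs
  parity-cong []       P≗Q = refl
  parity-cong (x ∷ xs) P≗Q =
    cong₂ _xor_ (P≗Q x (here refl)) (parity-cong xs (λ y y∈xs → P≗Q y (there y∈xs)))

  parity-false : ∀ {P : A → Bool} xs → (∀ x → x ∈ xs → P x ≡ false) → parity P xs ≡ false
  parity-false []       P≗false = refl
  parity-false (x ∷ xs) P≗false rewrite P≗false x (here refl) =
    parity-false xs (λ y y∈xs → P≗false y (there y∈xs))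

  parity-true : ∀ {P : A → Bool} xs → parity P xs ≡ true → ∃ λ x → x ∈ xs × P x ≡ true
  parity-true {P} (x ∷ xs) odd with P x in Px
  ... | true  = x , here refl , Px
  ... | false = let y , y∈xs , Py = parity-true xs odd in y , there y∈xs , Py

  parity-xor : ∀ (P Q : A → Bool) xs → parity (λ x → P x xor Q x) xs ≡ parity P xs xor parity Q xs
  parity-xor P Q []       = refl
  parity-xor P Q (x ∷ xs) =
    trans (cong ((P x xor Q x) xor_) (parity-xor P Q xs)) (⊕.interchange (P x) (Q x) _ _)

  parity-∧ˡ : ∀ b (P : A → Bool) xs → parity (λ x → b ∧ P x) xs ≡ b ∧ parity P xs
  parity-∧ˡ false P xs = parity-false xs (λ _ _ → refl)
  parity-∧ˡ true  P xs = refl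

  parity-single : ∀ {P : A → Bool} {q} xs → Unique xs → q ∈ xs →
                  (∀ x → x ∈ xs → x ≢ q → P x ≡ false) → parity P xs ≡ P q
  parity-single {P} (x ∷ xs) (x∉xs ∷ _) (here refl) others =
    trans (cong (P x xor_) (parity-false xs (λ y y∈xs → others y (there y∈xs) (≢-sym (lookup x∉xs y∈xs)))))
          (xor-identityʳ (P x))
  parity-single (x ∷ xs) (x∉xs ∷ unique) (there q∈xs) others
    rewrite others x (here refl) (lookup x∉xs q∈xs) =
    parity-single xs unique q∈xs (λ y y∈xs → others y (there y∈xs))

  parity-pair : ∀ {P : A → Bool} {q r} xs → Unique xs → q ∈ xs → r ∈ xs → q ≢ r →
                (∀ x → x ∈ xs → x ≢ q → x ≢ r → P x ≡ false) → parity P xs ≡ P q xor P r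
  parity-pair (x ∷ xs) _ (here refl) (here refl) q≢r others = ⊥-elim (q≢r refl)
  parity-pair {P} (x ∷ xs) (x∉xs ∷ unique) (here refl) (there r∈xs) q≢r others =
    cong (P x xor_) (parity-single xs unique r∈xs λ y y∈xs →
      others y (there y∈xs) (≢-sym (lookup x∉xs y∈xs)))
  parity-pair {P} {q} (x ∷ xs) (x∉xs ∷ unique) (there q∈xs) (here refl) q≢r others =
    trans (cong (P x xor_) (parity-single xs unique q∈xs λ y y∈xs y≢q →
             others y (there y∈xs) y≢q (≢-sym (lookup x∉xs y∈xs))))
          (xor-comm (P x) (P q))
  parity-pair (x ∷ xs) (x∉xs ∷ unique) (there q∈xs) (there r∈xs) q≢r others
    rewrite others x (here refl) (lookup x∉xs q∈xs) (lookup x∉xs r∈xs) =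
    parity-pair xs unique q∈xs r∈xs q≢r (λ y y∈xs → others y (there y∈xs))

sumOver-map : ∀ {A B : Set} (f : B → ℕ) (g : A → B) xs → sumOver f (map g xs) ≡ sumOver (f ∘ g) xs
sumOver-map f g []       = refl
sumOver-map f g (x ∷ xs) = cong (f (g x) +_) (sumOver-map f g xs)

module _ {A B : Set} where

  sumOver-cartesianProduct : ∀ (f : A × B → ℕ) xs ys →
    sumOver f (cartesianProduct xs ys) ≡ sumOver (λ x → sumOver (λ y → f (x , y)) ys) xs
  sumOver-cartesianProduct f []       ys = refl
  sumOver-cartesianProduct f (x ∷ xs) ys =
    trans (sumOver-++ f (map (x ,_) ys) (cartesianProduct xs ys))
          (cong₂ _+_ (sumOver-map f (x ,_) ys) (sumOver-cartesianProduct f xs ys))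

  sumOver-comm : ∀ (f : A → B → ℕ) xs ys →
                 sumOver (λ x → sumOver (f x) ys) xs ≡ sumOver (λ y → sumOver (λ x → f x y) xs) ys
  sumOver-comm f []       ys = sym (sumOver-zero ys)
    where
      sumOver-zero : ∀ (ys : List B) → sumOver (λ _ → 0) ys ≡ 0
      sumOver-zero []       = refl
      sumOver-zero (y ∷ ys) = sumOver-zero ys
  sumOver-comm f (x ∷ xs) ys =
    trans (cong (sumOver (f x) ys +_) (sumOver-comm f xs ys)) (sym (sumOver-+ (f x) _ ys))

  parity-comm : ∀ (P : A → B → Bool) xs ys →
                parity (λ x → parity (P x) ys) xs ≡ parity (λ y → parity (λ x → P x y) xs) ys
  parity-comm P []       ys = sym (parity-false ys (λ _ _ → refl))
  parity-comm P (x ∷ xs) ys =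
    trans (cong (parity (P x) ys xor_) (parity-comm P xs ys)) (sym (parity-xor (P x) _ ys))

module _ {n : ℕ} where

  _==_ : Fin n → Fin n → Bool
  x == y = does (x ≟ y)

  ==-refl : ∀ x → (x == x) ≡ true
  ==-refl x = dec-true (x ≟ x) refl

  ==-≢ : ∀ {x y} → x ≢ y → (x == y) ≡ false
  ==-≢ {x} {y} = dec-false (x ≟ y)

  _≟ₜ_ : DecidableEquality (Triple n)
  _≟ₜ_ = ≡-dec _≟_ (≡-dec _≟_ _≟_)

  _==ₜ_ : Triple n → Triple n → Bool
  s ==ₜ t = does (s ≟ₜ t)

  _∈₃_ : Fin n → Triple n → Set
  v ∈₃ (p , q , r) = v ≡ p ⊎ v ≡ q ⊎ v ≡ r

  _∈ᵥ_ : Fin n → Triple n → Bool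
  v ∈ᵥ (p , q , r) = (v == p) ∨ (v == q) ∨ (v == r)

  ∈ᵥ⇒∈₃ : ∀ {v} t → v ∈ᵥ t ≡ true → v ∈₃ t
  ∈ᵥ⇒∈₃ {v} (p , q , r) v∈t with v ≟ p | v ≟ q | v ≟ r
  ... | yes v≡p | _       | _       = inj₁ v≡p
  ... | no _    | yes v≡q | _       = inj₂ (inj₁ v≡q)
  ... | no _    | no _    | yes v≡r = inj₂ (inj₂ v≡r)

  ∈₃⇒∈ᵥ : ∀ {v} t → v ∈₃ t → v ∈ᵥ t ≡ true
  ∈₃⇒∈ᵥ {v} (p , q , r) (inj₁ refl)        rewrite ==-refl v = refl
  ∈₃⇒∈ᵥ {v} (p , q , r) (inj₂ (inj₁ refl)) rewrite ==-refl v = ∨-zeroʳ (v == p)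
  ∈₃⇒∈ᵥ {v} (p , q , r) (inj₂ (inj₂ refl)) rewrite ==-refl v | ∨-zeroʳ (v == q) = ∨-zeroʳ (v == p)

  ∉ᵥ⊎∈₃ : ∀ v t → v ∈ᵥ t ≡ false ⊎ v ∈₃ t
  ∉ᵥ⊎∈₃ v t with v ∈ᵥ t in v∈t
  ... | false = inj₁ refl
  ... | true  = inj₂ (∈ᵥ⇒∈₃ t v∈t)

  hasEdge : Triple n → Fin n → Fin n → Bool
  hasEdge t x y = x ∈ᵥ t ∧ y ∈ᵥ t ∧ not (x == y)

  hasEdge⇒ : ∀ {t x y} → hasEdge t x y ≡ true → x ∈ᵥ t ≡ true × y ∈ᵥ t ≡ true × x ≢ y
  hasEdge⇒ {t} {x} {y} t∋xy with x ∈ᵥ t | y ∈ᵥ t | x ≟ y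
  ... | true | true | no x≢y = refl , refl , x≢y

  hasEdge⇐ : ∀ {t x y} → x ∈ᵥ t ≡ true → y ∈ᵥ t ≡ true → x ≢ y → hasEdge t x y ≡ true
  hasEdge⇐ x∈t y∈t x≢y rewrite x∈t | y∈t | ==-≢ x≢y = refl

  first-edge : ∀ {a b c} → a ≢ b × a ≢ c × b ≢ c → hasEdge (a , b , c) a b ≡ true
  first-edge {a} {b} {c} (a≢b , _ , _) =
    hasEdge⇐ {t = a , b , c} (∈₃⇒∈ᵥ (a , b , c) (inj₁ refl)) (∈₃⇒∈ᵥ (a , b , c) (inj₂ (inj₁ refl)))
             a≢b

  hasEdge-∉ᵥ : ∀ {t v} w → v ∈ᵥ t ≡ false → hasEdge t v w ≡ false
  hasEdge-∉ᵥ w v∉t rewrite v∉t = refl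

  hasEdge-sym : ∀ t x y → hasEdge t x y ≡ hasEdge t y x
  hasEdge-sym t x y with x ∈ᵥ t | y ∈ᵥ t | x ≟ y | y ≟ x
  ... | true  | true  | yes _   | yes _   = refl
  ... | true  | true  | no _    | no _    = refl
  ... | true  | true  | yes x≡y | no y≢x  = ⊥-elim (y≢x (sym x≡y))
  ... | true  | true  | no x≢y  | yes y≡x = ⊥-elim (x≢y (sym y≡x))
  ... | true  | false | _       | _       = refl
  ... | false | true  | _       | _       = refl
  ... | false | false | _       | _       = refl

  hasEdge-cases : ∀ {a b c x y} → hasEdge (a , b , c) x y ≡ true →
    (x ≡ a × y ≡ b) ⊎ (x ≡ b × y ≡ a) ⊎ (x ≡ a × y ≡ c) ⊎
    (x ≡ c × y ≡ a) ⊎ (x ≡ b × y ≡ c) ⊎ (x ≡ c × y ≡ b)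
  hasEdge-cases {a} {b} {c} {x} {y} t∋xy with hasEdge⇒ {a , b , c} {x} {y} t∋xy
  ... | x∈t , y∈t , x≢y with ∈ᵥ⇒∈₃ {x} (a , b , c) x∈t | ∈ᵥ⇒∈₃ {y} (a , b , c) y∈t
  ... | inj₁ refl        | inj₁ refl        = ⊥-elim (x≢y refl)
  ... | inj₁ x≡a         | inj₂ (inj₁ y≡b)  = inj₁ (x≡a , y≡b)
  ... | inj₁ x≡a         | inj₂ (inj₂ y≡c)  = inj₂ (inj₂ (inj₁ (x≡a , y≡c)))
  ... | inj₂ (inj₁ x≡b)  | inj₁ y≡a         = inj₂ (inj₁ (x≡b , y≡a))
  ... | inj₂ (inj₁ refl) | inj₂ (inj₁ refl) = ⊥-elim (x≢y refl)
  ... | inj₂ (inj₁ x≡b)  | inj₂ (inj₂ y≡c)  = inj₂ (inj₂ (inj₂ (inj₂ (inj₁ (x≡b , y≡c)))))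
  ... | inj₂ (inj₂ x≡c)  | inj₁ y≡a         = inj₂ (inj₂ (inj₂ (inj₁ (x≡c , y≡a))))
  ... | inj₂ (inj₂ x≡c)  | inj₂ (inj₁ y≡b)  = inj₂ (inj₂ (inj₂ (inj₂ (inj₂ (x≡c , y≡b)))))
  ... | inj₂ (inj₂ refl) | inj₂ (inj₂ refl) = ⊥-elim (x≢y refl)

  first-vertex-neighbours : ∀ {p q r w : Fin n} → hasEdge (p , q , r) p w ≡ true → w ≡ q ⊎ w ≡ r
  first-vertex-neighbours {p} {q} {r} {w} t∋pw with hasEdge⇒ {t = p , q , r} t∋pw
  ... | _ , w∈t , p≢w with ∈ᵥ⇒∈₃ {v = w} (p , q , r) w∈t
  ... | inj₁ w≡p     = ⊥-elim (p≢w (sym w≡p))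
  ... | inj₂ w≡q⊎w≡r = w≡q⊎w≡r

  _≈ᵥ_ : Triple n → Triple n → Set
  t ≈ᵥ t′ = ∀ v → v ∈ᵥ t ≡ v ∈ᵥ t′

  ≈ᵥ-swap₁₂ : ∀ a b c → (a , b , c) ≈ᵥ (b , a , c)
  ≈ᵥ-swap₁₂ a b c v = ∨.x∙yz≈y∙xz (v == a) (v == b) (v == c)

  ≈ᵥ-swap₂₃ : ∀ a b c → (a , b , c) ≈ᵥ (a , c , b)
  ≈ᵥ-swap₂₃ a b c v = ∨.x∙yz≈x∙zy (v == a) (v == b) (v == c)

  ≈ᵥ-rotateʳ : ∀ a b c → (a , b , c) ≈ᵥ (c , a , b)
  ≈ᵥ-rotateʳ a b c v = ∨.x∙yz≈z∙xy (v == a) (v == b) (v == c)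

  ≈ᵥ-rotateˡ : ∀ a b c → (a , b , c) ≈ᵥ (b , c , a)
  ≈ᵥ-rotateˡ a b c v = ∨.x∙yz≈y∙zx (v == a) (v == b) (v == c)

  ≈ᵥ-reverse : ∀ a b c → (a , b , c) ≈ᵥ (c , b , a)
  ≈ᵥ-reverse a b c v = ∨.x∙yz≈z∙yx (v == a) (v == b) (v == c)

  hasEdge-≈ᵥ : ∀ {t t′ : Triple n} → t ≈ᵥ t′ → ∀ x y → hasEdge t x y ≡ hasEdge t′ x y
  hasEdge-≈ᵥ t≈t′ x y = cong₂ (λ a b → a ∧ b ∧ not (x == y)) (t≈t′ x) (t≈t′ y)

  Sorted : Triple n → Set
  Sorted (p , q , r) = p Fin.< q × q Fin.< r

  sorted⇒distinct : ∀ {p q r} → Sorted (p , q , r) → p ≢ q × p ≢ r × q ≢ r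
  sorted⇒distinct (p<q , q<r) = <⇒≢ p<q , <⇒≢ (<-trans p<q q<r) , <⇒≢ q<r

  private
    least : ∀ {p q r v} → Sorted (p , q , r) → v ∈₃ (p , q , r) → p Fin.≤ v
    least _           (inj₁ refl)        = ℕ.≤-refl
    least (p<q , _)   (inj₂ (inj₁ refl)) = ℕ.<⇒≤ p<q
    least (p<q , q<r) (inj₂ (inj₂ refl)) = ℕ.<⇒≤ (<-trans p<q q<r)

    greatest : ∀ {p q r v} → Sorted (p , q , r) → v ∈₃ (p , q , r) → v Fin.≤ r
    greatest (p<q , q<r) (inj₁ refl)        = ℕ.<⇒≤ (<-trans p<q q<r)
    greatest (_ , q<r)   (inj₂ (inj₁ refl)) = ℕ.<⇒≤ q<r
    greatest _           (inj₂ (inj₂ refl)) = ℕ.≤-refl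

  sorted-≈ᵥ⇒≡ : ∀ {t t′} → Sorted t → Sorted t′ → t ≈ᵥ t′ → t ≡ t′
  sorted-≈ᵥ⇒≡ {p , q , r} {a , b , c} t↑ t′↑ t≈t′
    with ≤-antisym (least t↑ (in-t a (inj₁ refl))) (least t′↑ (in-t′ p (inj₁ refl)))
       | ≤-antisym (greatest t′↑ (in-t′ r (inj₂ (inj₂ refl)))) (greatest t↑ (in-t c (inj₂ (inj₂ refl))))
       | in-t′ q (inj₂ (inj₁ refl))
    where
      in-t′ : ∀ v → v ∈₃ (p , q , r) → v ∈₃ (a , b , c)
      in-t′ v v∈t = ∈ᵥ⇒∈₃ (a , b , c) (trans (sym (t≈t′ v)) (∈₃⇒∈ᵥ (p , q , r) v∈t))
      in-t : ∀ v → v ∈₃ (a , b , c) → v ∈₃ (p , q , r)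
      in-t v v∈t′ = ∈ᵥ⇒∈₃ (p , q , r) (trans (t≈t′ v) (∈₃⇒∈ᵥ (a , b , c) v∈t′))
  ... | refl | refl | inj₁ refl        = ⊥-elim (<⇒≢ (proj₁ t↑) refl)
  ... | refl | refl | inj₂ (inj₁ refl) = refl
  ... | refl | refl | inj₂ (inj₂ refl) = ⊥-elim (<⇒≢ (proj₂ t↑) refl)

module _ {n : ℕ} (gs : List (Triple n)) where

  face⇒triple : ∀ {x y z} → Face gs x y z → ∃ λ t → t ∈ gs × t ≈ᵥ (x , y , z)
  face⇒triple             (inj₁ m)                             = _ , m , λ _ → refl
  face⇒triple {x} {y} {z} (inj₂ (inj₁ m))                      = _ , m , ≈ᵥ-swap₂₃ x z y
  face⇒triple {x} {y} {z} (inj₂ (inj₂ (inj₁ m)))               = _ , m , ≈ᵥ-swap₁₂ y x z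
  face⇒triple {x} {y} {z} (inj₂ (inj₂ (inj₂ (inj₁ m))))        = _ , m , ≈ᵥ-rotateʳ y z x
  face⇒triple {x} {y} {z} (inj₂ (inj₂ (inj₂ (inj₂ (inj₁ m))))) = _ , m , ≈ᵥ-rotateˡ z x y
  face⇒triple {x} {y} {z} (inj₂ (inj₂ (inj₂ (inj₂ (inj₂ m))))) = _ , m , ≈ᵥ-reverse z y x

  triple⇒face : ∀ {t x y} → t ∈ gs → hasEdge t x y ≡ true → ∃ λ w → Face gs x y w × t ≈ᵥ (x , y , w)
  triple⇒face {p , q , r} {x} {y} m t∋xy with hasEdge-cases {a = p} {b = q} {c = r} {x = x} {y = y} t∋xy
  ... | inj₁ (refl , refl)                             = r , inj₁ m , λ _ → refl
  ... | inj₂ (inj₁ (refl , refl))                      = r , inj₂ (inj₂ (inj₁ m)) , ≈ᵥ-swap₁₂ p q r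
  ... | inj₂ (inj₂ (inj₁ (refl , refl)))               = q , inj₂ (inj₁ m) , ≈ᵥ-swap₂₃ p q r
  ... | inj₂ (inj₂ (inj₂ (inj₁ (refl , refl))))        = q , inj₂ (inj₂ (inj₂ (inj₁ m))) , ≈ᵥ-rotateʳ p q r
  ... | inj₂ (inj₂ (inj₂ (inj₂ (inj₁ (refl , refl))))) = p , inj₂ (inj₂ (inj₂ (inj₂ (inj₁ m)))) , ≈ᵥ-rotateˡ p q r
  ... | inj₂ (inj₂ (inj₂ (inj₂ (inj₂ (refl , refl))))) = p , inj₂ (inj₂ (inj₂ (inj₂ (inj₂ m)))) , ≈ᵥ-reverse p q r

-- Chains over ℤ/2 and cycles

-- A chain is the indicator function of its support (xor is addition); a 1-chain
-- is recorded on ordered pairs and a cycle is required to be symmetric.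
Chain₁ : ℕ → Set
Chain₁ n = Fin n → Fin n → Bool

Chain₂ : ℕ → Set
Chain₂ n = Triple n → Bool

module _ {n : ℕ} where

  record IsCycle (z : Chain₁ n) : Set where
    field
      symmetric : ∀ x y → z x y ≡ z y x
      even      : ∀ v → parity (z v) (allFin n) ≡ false

  open IsCycle public

  _⊆ₑ_ : Chain₁ n → Chain₁ n → Set
  z ⊆ₑ E = ∀ x y → z x y ≡ true → E x y ≡ true

  private
    even-at-first-vertex : ∀ {p q r} → p ≢ q → p ≢ r → q ≢ r →
                           parity (hasEdge (p , q , r) p) (allFin n) ≡ false
    even-at-first-vertex {p} {q} {r} p≢q p≢r q≢r =
      trans (parity-pair (allFin n) (allFin⁺ n) (∈-allFin q) (∈-allFin r) q≢r others)
            (cong₂ _xor_ (first-edge (p≢q , p≢r , q≢r))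
                         (trans (hasEdge-≈ᵥ (≈ᵥ-swap₂₃ p q r) p r) (first-edge (p≢r , p≢q , ≢-sym q≢r))))
      where
        others : ∀ w → w ∈ allFin n → w ≢ q → w ≢ r → hasEdge (p , q , r) p w ≡ false
        others w _ w≢q w≢r = ¬-not λ t∋pw → [ w≢q , w≢r ]′ (first-vertex-neighbours {p = p} t∋pw)

  triangle-isCycle : ∀ {p q r} → p ≢ q × p ≢ r × q ≢ r → IsCycle (hasEdge (p , q , r))
  triangle-isCycle {p} {q} {r} _ .symmetric = hasEdge-sym (p , q , r)
  triangle-isCycle {p} {q} {r} (p≢q , p≢r , q≢r) .even v with ∉ᵥ⊎∈₃ v (p , q , r)
  ... | inj₁ v∉t                = parity-false (allFin n) (λ w _ → hasEdge-∉ᵥ {t = p , q , r} {v = v} w v∉t)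
  ... | inj₂ (inj₁ refl)        = even-at-first-vertex p≢q p≢r q≢r
  ... | inj₂ (inj₂ (inj₁ refl)) =
    trans (parity-cong (allFin n) (λ w _ → hasEdge-≈ᵥ (≈ᵥ-swap₁₂ p q r) v w))
          (even-at-first-vertex (≢-sym p≢q) q≢r p≢r)
  ... | inj₂ (inj₂ (inj₂ refl)) =
    trans (parity-cong (allFin n) (λ w _ → hasEdge-≈ᵥ (≈ᵥ-rotateʳ p q r) v w))
          (even-at-first-vertex (≢-sym p≢r) (≢-sym q≢r) p≢q)

  isCycle-xor : ∀ {z z′} → IsCycle z → IsCycle z′ → IsCycle (λ x y → z x y xor z′ x y)
  isCycle-xor z-cyc z′-cyc .symmetric x y = cong₂ _xor_ (z-cyc .symmetric x y) (z′-cyc .symmetric x y)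
  isCycle-xor {z} {z′} z-cyc z′-cyc .even v =
    trans (parity-xor (z v) (z′ v) (allFin n)) (cong₂ _xor_ (z-cyc .even v) (z′-cyc .even v))

  isCycle-∧ˡ : ∀ b {z} → IsCycle z → IsCycle (λ x y → b ∧ z x y)
  isCycle-∧ˡ b z-cyc .symmetric x y = cong (b ∧_) (z-cyc .symmetric x y)
  isCycle-∧ˡ b {z} z-cyc .even v =
    trans (parity-∧ˡ b (z v) (allFin n)) (trans (cong (b ∧_) (z-cyc .even v)) (∧-zeroʳ b))

  cycle-pendant-edge : ∀ {z v u} → IsCycle z → (∀ w → z v w ≡ true → w ≡ u) → z v u ≡ false
  cycle-pendant-edge {z} {v} {u} z-cyc only-u =
    trans (sym (parity-single (allFin n) (allFin⁺ n) (∈-allFin u) others)) (z-cyc .even v)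
    where
      others : ∀ w → w ∈ allFin n → w ≢ u → z v w ≡ false
      others w _ w≢u = ¬-not λ vw∈z → w≢u (only-u w vw∈z)

  cycle-degree-two : ∀ {z v p q} → IsCycle z → p ≢ q → (∀ w → z v w ≡ true → w ≡ p ⊎ w ≡ q) →
                     z v p ≡ z v q
  cycle-degree-two {z} {v} {p} {q} z-cyc p≢q only-pq =
    xor≡false⇒≡ (trans (sym (parity-pair (allFin n) (allFin⁺ n) (∈-allFin p) (∈-allFin q) p≢q others))
                       (z-cyc .even v))
    where
      others : ∀ w → w ∈ allFin n → w ≢ p → w ≢ q → z v w ≡ false
      others w _ w≢p w≢q = ¬-not λ vw∈z → [ w≢p , w≢q ]′ (only-pq w vw∈z)

  cycle-on-triangle : ∀ {z a b c} → IsCycle z → a ≢ b × a ≢ c × b ≢ c → z ⊆ₑ hasEdge (a , b , c) →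
                      ∀ x y → z x y ≡ z a b ∧ hasEdge (a , b , c) x y
  cycle-on-triangle {z} {a} {b} {c} z-cyc (a≢b , a≢c , b≢c) z⊆abc x y with hasEdge (a , b , c) x y in abc∋xy
  ... | false = trans (¬-not λ xy∈z → true≢false (trans (sym (z⊆abc x y xy∈z)) abc∋xy)) (sym (∧-zeroʳ (z a b)))
  ... | true  = trans (on-edges (hasEdge-cases {a = a} {b = b} {c = c} {x = x} {y = y} abc∋xy))
                      (sym (∧-identityʳ (z a b)))
    where
      ab≡ac : z a b ≡ z a c
      ab≡ac = cycle-degree-two z-cyc b≢c λ w aw∈z → first-vertex-neighbours {p = a} (z⊆abc a w aw∈z)
      ba≡bc : z b a ≡ z b c
      ba≡bc = cycle-degree-two z-cyc a≢c λ w bw∈z →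
        first-vertex-neighbours {p = b} (trans (hasEdge-≈ᵥ (≈ᵥ-swap₁₂ b a c) b w) (z⊆abc b w bw∈z))
      on-edges : (x ≡ a × y ≡ b) ⊎ (x ≡ b × y ≡ a) ⊎ (x ≡ a × y ≡ c) ⊎ (x ≡ c × y ≡ a) ⊎
                 (x ≡ b × y ≡ c) ⊎ (x ≡ c × y ≡ b) → z x y ≡ z a b
      on-edges (inj₁ (refl , refl))                             = refl
      on-edges (inj₂ (inj₁ (refl , refl)))                      = z-cyc .symmetric b a
      on-edges (inj₂ (inj₂ (inj₁ (refl , refl))))               = sym ab≡ac
      on-edges (inj₂ (inj₂ (inj₂ (inj₁ (refl , refl)))))        = trans (z-cyc .symmetric c a) (sym ab≡ac)
      on-edges (inj₂ (inj₂ (inj₂ (inj₂ (inj₁ (refl , refl)))))) = trans (sym ba≡bc) (z-cyc .symmetric b a)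
      on-edges (inj₂ (inj₂ (inj₂ (inj₂ (inj₂ (refl , refl)))))) =
        trans (z-cyc .symmetric c b) (trans (sym ba≡bc) (z-cyc .symmetric b a))

module _ {n : ℕ} where

  _<ᵇ_ : Fin n → Fin n → Bool
  x <ᵇ y = does (x Fin.<? y)

  pairs : List (Fin n × Fin n)
  pairs = cartesianProduct (allFin n) (allFin n)

  #edges : Chain₁ n → ℕ
  #edges E = count (λ (x , y) → (x <ᵇ y) ∧ E x y) pairs

  degree : Chain₁ n → Fin n → ℕ
  degree E v = count (E v) (allFin n)

  handshake : ∀ E → (∀ x y → E x y ≡ E y x) → (∀ x → E x x ≡ false) →
              sumOver (degree E) (allFin n) ≡ #edges E + #edges E
  handshake E E-sym E-irrefl = begin
    sumOver (degree E) (allFin n)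
      ≡⟨ sumOver-cartesianProduct (λ (x , y) → ⟦ E x y ⟧) (allFin n) (allFin n) ⟨
    sumOver (λ (x , y) → ⟦ E x y ⟧) pairs
      ≡⟨ sumOver-cong pairs (λ (x , y) _ → split x y) ⟩
    sumOver (λ (x , y) → ⟦ (x <ᵇ y) ∧ E x y ⟧ + ⟦ (y <ᵇ x) ∧ E x y ⟧) pairs
      ≡⟨ sumOver-+ _ _ pairs ⟩
    #edges E + count (λ (x , y) → (y <ᵇ x) ∧ E x y) pairs
      ≡⟨ cong (#edges E +_) transpose ⟩
    #edges E + #edges E
      ∎
    where
      open ≡-Reasoning
      split : ∀ x y → ⟦ E x y ⟧ ≡ ⟦ (x <ᵇ y) ∧ E x y ⟧ + ⟦ (y <ᵇ x) ∧ E x y ⟧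
      split x y with <-cmp x y
      ... | tri< x<y _ y≮x rewrite dec-true (x Fin.<? y) x<y | dec-false (y Fin.<? x) y≮x = sym (ℕ.+-identityʳ _)
      ... | tri≈ _ refl _  rewrite E-irrefl x | ∧-zeroʳ (x <ᵇ x) = refl
      ... | tri> x≮y _ y<x rewrite dec-false (x Fin.<? y) x≮y | dec-true (y Fin.<? x) y<x = refl
      transpose : count (λ (x , y) → (y <ᵇ x) ∧ E x y) pairs ≡ #edges E
      transpose = begin
        count (λ (x , y) → (y <ᵇ x) ∧ E x y) pairs
          ≡⟨ sumOver-cartesianProduct (λ (x , y) → ⟦ (y <ᵇ x) ∧ E x y ⟧) (allFin n) (allFin n) ⟩
        sumOver (λ x → count (λ y → (y <ᵇ x) ∧ E x y) (allFin n)) (allFin n)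
          ≡⟨ sumOver-comm (λ x y → ⟦ (y <ᵇ x) ∧ E x y ⟧) (allFin n) (allFin n) ⟩
        sumOver (λ y → count (λ x → (y <ᵇ x) ∧ E x y) (allFin n)) (allFin n)
          ≡⟨ sumOver-cong (allFin n) (λ y _ → count-cong (allFin n) (λ x _ → cong ((y <ᵇ x) ∧_) (E-sym x y))) ⟩
        sumOver (λ y → count (λ x → (y <ᵇ x) ∧ E y x) (allFin n)) (allFin n)
          ≡⟨ sumOver-cartesianProduct (λ (y , x) → ⟦ (y <ᵇ x) ∧ E y x ⟧) (allFin n) (allFin n) ⟨
        #edges E
          ∎

  _≅ₑ_ : Fin n × Fin n → Fin n × Fin n → Set
  (a , b) ≅ₑ (x , y) = (a ≡ x × b ≡ y) ⊎ (a ≡ y × b ≡ x)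

  _≅ₑ?_ : ∀ e e′ → Dec (e ≅ₑ e′)
  (a , b) ≅ₑ? (x , y) = (a ≟ x ×-dec b ≟ y) ⊎-dec (a ≟ y ×-dec b ≟ x)

  ≅ₑ-swap : ∀ {a b e} → (a , b) ≅ₑ e → (b , a) ≅ₑ e
  ≅ₑ-swap (inj₁ (a≡x , b≡y)) = inj₂ (b≡y , a≡x)
  ≅ₑ-swap (inj₂ (a≡y , b≡x)) = inj₁ (b≡x , a≡y)

  _∖ₑ_ : Chain₁ n → Fin n × Fin n → Chain₁ n
  (E ∖ₑ e) a b = E a b ∧ not (does ((a , b) ≅ₑ? e))

  ∖ₑ-sym : ∀ E e → (∀ a b → E a b ≡ E b a) → ∀ a b → (E ∖ₑ e) a b ≡ (E ∖ₑ e) b a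
  ∖ₑ-sym E e E-sym a b =
    cong₂ (λ u v → u ∧ not v) (E-sym a b) (does-⇔ (mk⇔ ≅ₑ-swap ≅ₑ-swap) ((a , b) ≅ₑ? e) ((b , a) ≅ₑ? e))

  ∖ₑ-flip : ∀ E x y a b → (E ∖ₑ (y , x)) a b ≡ (E ∖ₑ (x , y)) a b
  ∖ₑ-flip E x y a b = cong (λ v → E a b ∧ not v)
    (does-⇔ (mk⇔ [ inj₂ , inj₁ ]′ [ inj₂ , inj₁ ]′) ((a , b) ≅ₑ? (y , x)) ((a , b) ≅ₑ? (x , y)))

  ∖ₑ-unchanged : ∀ E {e a b} → ¬ (a , b) ≅ₑ e → (E ∖ₑ e) a b ≡ E a b
  ∖ₑ-unchanged E {e} {a} {b} ab≇e =
    trans (cong (λ v → E a b ∧ not v) (dec-false ((a , b) ≅ₑ? e) ab≇e)) (∧-identityʳ (E a b))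

  ∖ₑ-kept : ∀ E {e a b} → E a b ≡ true → ¬ (a , b) ≅ₑ e → (E ∖ₑ e) a b ≡ true
  ∖ₑ-kept E Eab ab≇e = trans (∖ₑ-unchanged E ab≇e) Eab

  ∖ₑ-⊆ : ∀ E e a b → (E ∖ₑ e) a b ≡ true → E a b ≡ true × ¬ (a , b) ≅ₑ e
  ∖ₑ-⊆ E e a b E′ab with E a b
  ... | true = refl , λ ab≅e → true≢false (trans (sym E′ab) (cong not (dec-true ((a , b) ≅ₑ? e) ab≅e)))

  private
    #edges-∖ₑ-< : ∀ E {p q} → p Fin.< q → E p q ≡ true → #edges E ≡ suc (#edges (E ∖ₑ (p , q)))
    #edges-∖ₑ-< E {p} {q} p<q Epq = count-suc-at pairs (cartesianProduct⁺ (allFin⁺ n) (allFin⁺ n))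
      (∈-cartesianProduct⁺ (∈-allFin p) (∈-allFin q)) counted-before not-counted-after same-elsewhere
      where
        counted-before : (p <ᵇ q) ∧ E p q ≡ true
        counted-before rewrite dec-true (p Fin.<? q) p<q = Epq
        not-counted-after : (p <ᵇ q) ∧ (E ∖ₑ (p , q)) p q ≡ false
        not-counted-after rewrite dec-true ((p , q) ≅ₑ? (p , q)) (inj₁ (refl , refl)) | ∧-zeroʳ (E p q) =
          ∧-zeroʳ (p <ᵇ q)
        same-elsewhere : ∀ ((a , b) : Fin n × Fin n) → (a , b) ∈ pairs → (a , b) ≢ (p , q) →
                         (a <ᵇ b) ∧ E a b ≡ (a <ᵇ b) ∧ (E ∖ₑ (p , q)) a b
        same-elsewhere (a , b) _ ab≢pq with (a , b) ≅ₑ? (p , q)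
        ... | no ab≇pq                 = cong ((a <ᵇ b) ∧_) (sym (∖ₑ-unchanged E ab≇pq))
        ... | yes (inj₁ (refl , refl)) = ⊥-elim (ab≢pq refl)
        ... | yes (inj₂ (refl , refl)) rewrite dec-false (q Fin.<? p) (<-asym p<q) = refl

  #edges-∖ₑ : ∀ E {x y} → (∀ a b → E a b ≡ E b a) → x ≢ y → E x y ≡ true →
              #edges E ≡ suc (#edges (E ∖ₑ (x , y)))
  #edges-∖ₑ E {x} {y} E-sym x≢y Exy with <-cmp x y
  ... | tri< x<y _ _ = #edges-∖ₑ-< E x<y Exy
  ... | tri≈ _ x≡y _ = ⊥-elim (x≢y x≡y)
  ... | tri> _ _ y<x = trans (#edges-∖ₑ-< E y<x (trans (E-sym y x) Exy))
                             (cong suc (count-cong pairs (λ (a , b) _ → cong ((a <ᵇ b) ∧_) (∖ₑ-flip E x y a b))))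

module Boundary {n : ℕ} (fs : List (Triple n)) where

  ∂ : Chain₂ n → Chain₁ n
  ∂ Z x y = parity (λ t → Z t ∧ hasEdge t x y) fs

  ∂-cong : ∀ {Z Z′ : Chain₂ n} → (∀ t → t ∈ fs → Z t ≡ Z′ t) → ∀ x y → ∂ Z x y ≡ ∂ Z′ x y
  ∂-cong Z≗Z′ x y = parity-cong fs (λ t t∈fs → cong (_∧ hasEdge t x y) (Z≗Z′ t t∈fs))

  ∂-xor : ∀ (Z Z′ : Chain₂ n) x y → ∂ (λ t → Z t xor Z′ t) x y ≡ ∂ Z x y xor ∂ Z′ x y
  ∂-xor Z Z′ x y = trans (parity-cong fs (λ t _ → ∧-distribʳ-xor (hasEdge t x y) (Z t) (Z′ t)))
                         (parity-xor (λ t → Z t ∧ hasEdge t x y) (λ t → Z′ t ∧ hasEdge t x y) fs)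

  ∂-singleton : Unique fs → ∀ {s} → s ∈ fs → ∀ b x y →
                ∂ (λ t → b ∧ (t ==ₜ s)) x y ≡ b ∧ hasEdge s x y
  ∂-singleton unique {s} s∈fs b x y = trans (parity-single fs unique s∈fs others) at-s
    where
      others : ∀ t → t ∈ fs → t ≢ s → (b ∧ (t ==ₜ s)) ∧ hasEdge t x y ≡ false
      others t _ t≢s rewrite dec-false (t ≟ₜ s) t≢s | ∧-zeroʳ b = refl
      at-s : (b ∧ (s ==ₜ s)) ∧ hasEdge s x y ≡ b ∧ hasEdge s x y
      at-s rewrite dec-true (s ≟ₜ s) refl | ∧-identityʳ b = refl

  ∂-isCycle : (∀ {p q r} → (p , q , r) ∈ fs → p ≢ q × p ≢ r × q ≢ r) → ∀ Z → IsCycle (∂ Z)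
  ∂-isCycle _ Z .symmetric x y = parity-cong fs (λ t _ → cong (Z t ∧_) (hasEdge-sym t x y))
  ∂-isCycle distinct Z .even v = begin
    parity (λ w → parity (λ t → Z t ∧ hasEdge t v w) fs) (allFin n)
      ≡⟨ parity-comm (λ w t → Z t ∧ hasEdge t v w) (allFin n) fs ⟩
    parity (λ t → parity (λ w → Z t ∧ hasEdge t v w) (allFin n)) fs
      ≡⟨ parity-cong fs (λ t _ → parity-∧ˡ (Z t) (hasEdge t v) (allFin n)) ⟩
    parity (λ t → Z t ∧ parity (hasEdge t v) (allFin n)) fs
      ≡⟨ parity-false fs (λ t t∈fs → trans (cong (Z t ∧_) (even-at t∈fs)) (∧-zeroʳ (Z t))) ⟩
    false
      ∎
    where
      open ≡-Reasoning
      even-at : ∀ {t} → t ∈ fs → parity (hasEdge t v) (allFin n) ≡ false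
      even-at {p , q , r} t∈fs = triangle-isCycle (distinct t∈fs) .even v

module Disk {n : ℕ} {fs : List (Triple n)} (D : TriangulatedDisk fs) where
  open TriangulatedDisk D

  sorted∈ : ∀ {t} → t ∈ fs → Sorted t
  sorted∈ = lookup sorted

  face-distinct : ∀ {x y z} → Face fs x y z → x ≢ y × x ≢ z × y ≢ z
  face-distinct (inj₁ m) = sorted⇒distinct (sorted∈ m)
  face-distinct (inj₂ (inj₁ m)) =
    let xz , xy , zy = sorted⇒distinct (sorted∈ m) in xy , xz , ≢-sym zy
  face-distinct (inj₂ (inj₂ (inj₁ m))) =
    let yx , yz , xz = sorted⇒distinct (sorted∈ m) in ≢-sym yx , xz , yz
  face-distinct (inj₂ (inj₂ (inj₂ (inj₁ m)))) =
    let yz , yx , zx = sorted⇒distinct (sorted∈ m) in ≢-sym yx , ≢-sym zx , yz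
  face-distinct (inj₂ (inj₂ (inj₂ (inj₂ (inj₁ m))))) =
    let zx , zy , xy = sorted⇒distinct (sorted∈ m) in xy , ≢-sym zx , ≢-sym zy
  face-distinct (inj₂ (inj₂ (inj₂ (inj₂ (inj₂ m))))) =
    let zy , zx , yx = sorted⇒distinct (sorted∈ m) in ≢-sym yx , ≢-sym zx , ≢-sym zy

  ≈ᵥ⇒≡ : ∀ {t t′} → t ∈ fs → t′ ∈ fs → t ≈ᵥ t′ → t ≡ t′
  ≈ᵥ⇒≡ t∈fs t′∈fs = sorted-≈ᵥ⇒≡ (sorted∈ t∈fs) (sorted∈ t′∈fs)

  edge⇒≢ : ∀ {x y} → Edge fs x y → x ≢ y
  edge⇒≢ (_ , f) = proj₁ (face-distinct f)

  edge-sym : ∀ {x y} → Edge fs x y → Edge fs y x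
  edge-sym (z , inj₁ m)                             = z , inj₂ (inj₂ (inj₁ m))
  edge-sym (z , inj₂ (inj₁ m))                      = z , inj₂ (inj₂ (inj₂ (inj₁ m)))
  edge-sym (z , inj₂ (inj₂ (inj₁ m)))               = z , inj₁ m
  edge-sym (z , inj₂ (inj₂ (inj₂ (inj₁ m))))        = z , inj₂ (inj₁ m)
  edge-sym (z , inj₂ (inj₂ (inj₂ (inj₂ (inj₁ m))))) = z , inj₂ (inj₂ (inj₂ (inj₂ (inj₂ m))))
  edge-sym (z , inj₂ (inj₂ (inj₂ (inj₂ (inj₂ m))))) = z , inj₂ (inj₂ (inj₂ (inj₂ (inj₁ m))))

  edge? : ∀ x y → Dec (Edge fs x y)
  edge? x y = any? (face? fs x y)

  face⇒hasEdge : ∀ {x y z} → Face fs x y z →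
    ∃ λ t → t ∈ fs × t ≈ᵥ (x , y , z) × hasEdge t x y ≡ true × hasEdge t x z ≡ true
  face⇒hasEdge {x} {y} {z} f =
    let t , t∈fs , t≈xyz = face⇒triple fs f
        x≢y , x≢z , _ = face-distinct f
        vertex : ∀ {v} → v ∈₃ (x , y , z) → v ∈ᵥ t ≡ true
        vertex {v} v∈xyz = trans (t≈xyz v) (∈₃⇒∈ᵥ (x , y , z) v∈xyz)
    in t , t∈fs , t≈xyz , hasEdge⇐ {t = t} (vertex (inj₁ refl)) (vertex (inj₂ (inj₁ refl))) x≢y
                        , hasEdge⇐ {t = t} (vertex (inj₁ refl)) (vertex (inj₂ (inj₂ refl))) x≢z

  edge⇒triple : ∀ {x y} → Edge fs x y → ∃ λ t → t ∈ fs × hasEdge t x y ≡ true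
  edge⇒triple (_ , f) = let t , t∈fs , _ , t∋xy , _ = face⇒hasEdge f in t , t∈fs , t∋xy

  triple⇒edge : ∀ {t x y} → t ∈ fs → hasEdge t x y ≡ true → Edge fs x y
  triple⇒edge t∈fs t∋xy = let w , f , _ = triple⇒face fs t∈fs t∋xy in w , f

  some-edge-at : ∀ {t} v → t ∈ fs → v ∈ᵥ t ≡ true → ∃ λ x → hasEdge t v x ≡ true
  some-edge-at {p , q , r} v t∈fs v∈t with p ≟ v | sorted⇒distinct (sorted∈ t∈fs)
  ... | yes refl | p≢q , _ , _ =
    q , hasEdge⇐ {t = p , q , r} v∈t (∈₃⇒∈ᵥ (p , q , r) (inj₂ (inj₁ refl))) p≢q
  ... | no p≢v   | _ =
    p , hasEdge⇐ {t = p , q , r} v∈t (∈₃⇒∈ᵥ (p , q , r) (inj₁ refl)) (≢-sym p≢v)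

  third-vertex : ∀ {t} x y → t ∈ fs → hasEdge t x y ≡ true →
                 ∃ λ w → hasEdge t x w ≡ true × hasEdge t w y ≡ true × w ≢ x × w ≢ y
  third-vertex {t} x y t∈fs t∋xy =
    let w , f , t≈xyw = triple⇒face fs t∈fs t∋xy
        _ , x≢w , y≢w = face-distinct f
        vertex : ∀ {v} → v ∈₃ (x , y , w) → v ∈ᵥ t ≡ true
        vertex {v} v∈xyw = trans (t≈xyw v) (∈₃⇒∈ᵥ (x , y , w) v∈xyw)
    in w , hasEdge⇐ {t = t} (vertex (inj₁ refl)) (vertex (inj₂ (inj₂ refl))) x≢w
         , hasEdge⇐ {t = t} (vertex (inj₂ (inj₂ refl))) (vertex (inj₂ (inj₁ refl))) (≢-sym y≢w)
         , ≢-sym x≢w , ≢-sym y≢w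

  at-most-two : ∀ {t₁ t₂ t₃} x y → t₁ ∈ fs → t₂ ∈ fs → t₃ ∈ fs →
                hasEdge t₁ x y ≡ true → hasEdge t₂ x y ≡ true → hasEdge t₃ x y ≡ true →
                t₁ ≡ t₂ ⊎ t₁ ≡ t₃ ⊎ t₂ ≡ t₃
  at-most-two x y m₁ m₂ m₃ h₁ h₂ h₃
    with triple⇒face fs m₁ h₁ | triple⇒face fs m₂ h₂ | triple⇒face fs m₃ h₃
  ... | w₁ , f₁ , e₁ | w₂ , f₂ , e₂ | w₃ , f₃ , e₃
    with edgeDeg≤2 x y w₁ w₂ w₃ f₁ f₂ f₃
  ... | inj₁ refl        = inj₁ (≈ᵥ⇒≡ m₁ m₂ λ v → trans (e₁ v) (sym (e₂ v)))
  ... | inj₂ (inj₁ refl) = inj₂ (inj₁ (≈ᵥ⇒≡ m₁ m₃ λ v → trans (e₁ v) (sym (e₃ v))))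
  ... | inj₂ (inj₂ refl) = inj₂ (inj₂ (≈ᵥ⇒≡ m₂ m₃ λ v → trans (e₂ v) (sym (e₃ v))))

  boundary-edge-triple : ∀ {x y} → BoundaryEdge fs x y →
    ∃ λ s → s ∈ fs × hasEdge s x y ≡ true × (∀ u → u ∈ fs → hasEdge u x y ≡ true → u ≡ s)
  boundary-edge-triple (z , f , only-z) =
    let s , s∈fs , s≈xyz , s∋xy , _ = face⇒hasEdge f in
    s , s∈fs , s∋xy , λ u u∈fs u∋xy →
      let w , fw , u≈xyw = triple⇒face fs u∈fs u∋xy in
      ≈ᵥ⇒≡ u∈fs s∈fs λ v →
        trans (u≈xyw v) (trans (cong (λ w → v ∈ᵥ (_ , _ , w)) (only-z w fw)) (sym (s≈xyz v)))

  open Boundary fs public hiding (∂-isCycle)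

  ∂-isCycle : ∀ Z → IsCycle (∂ Z)
  ∂-isCycle = Boundary.∂-isCycle fs (λ t∈fs → sorted⇒distinct (sorted∈ t∈fs))

  ∂-at-two : ∀ Z x y {t u} → t ∈ fs → u ∈ fs → t ≢ u →
             hasEdge t x y ≡ true → hasEdge u x y ≡ true → ∂ Z x y ≡ Z t xor Z u
  ∂-at-two Z x y {t} {u} t∈fs u∈fs t≢u t∋xy u∋xy =
    trans (parity-pair fs distinct t∈fs u∈fs t≢u others)
          (cong₂ _xor_ (trans (cong (Z t ∧_) t∋xy) (∧-identityʳ (Z t)))
                       (trans (cong (Z u ∧_) u∋xy) (∧-identityʳ (Z u))))
    where
      others : ∀ v → v ∈ fs → v ≢ t → v ≢ u → Z v ∧ hasEdge v x y ≡ false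
      others v v∈fs v≢t v≢u = trans (cong (Z v ∧_) (¬-not not-at-xy)) (∧-zeroʳ (Z v))
        where
          not-at-xy : hasEdge v x y ≢ true
          not-at-xy v∋xy = case at-most-two x y t∈fs u∈fs v∈fs t∋xy u∋xy v∋xy of λ where
            (inj₁ t≡u)        → t≢u t≡u
            (inj₂ (inj₁ t≡v)) → v≢t (sym t≡v)
            (inj₂ (inj₂ u≡v)) → v≢u (sym u≡v)

  ∂-false-propagates : ∀ Z x y {t u} → ∂ Z x y ≡ false → t ∈ fs → u ∈ fs →
                       hasEdge t x y ≡ true → hasEdge u x y ≡ true → Z t ≡ Z u
  ∂-false-propagates Z x y {t} {u} ∂Z≡false t∈fs u∈fs t∋xy u∋xy with t ≟ₜ u
  ... | yes refl = refl
  ... | no t≢u   = xor≡false⇒≡ (trans (sym (∂-at-two Z x y t∈fs u∈fs t≢u t∋xy u∋xy)) ∂Z≡false)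

  record FreeEdge (Z : Chain₂ n) (t : Triple n) (x y : Fin n) : Set where
    constructor free-edge
    field
      face∈fs : t ∈ fs
      face∈Z  : Z t ≡ true
      face∋xy : hasEdge t x y ≡ true
      only    : ∀ u → u ∈ fs → Z u ≡ true → hasEdge u x y ≡ true → u ≡ t

  open FreeEdge

  ∂-true⇒free-edge : ∀ Z x y → ∂ Z x y ≡ true → ∃ λ t → FreeEdge Z t x y
  ∂-true⇒free-edge Z x y ∂Z≡true with parity-true fs ∂Z≡true
  ... | t , t∈fs , _ with Z t in Zt | hasEdge t x y in t∋xy
  ... | true | true = t , free-edge t∈fs Zt t∋xy only-t
    where
      only-t : ∀ u → u ∈ fs → Z u ≡ true → hasEdge u x y ≡ true → u ≡ t
      only-t u u∈fs Zu u∋xy with u ≟ₜ t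
      ... | yes u≡t = u≡t
      ... | no u≢t  with () ← trans (sym ∂Z≡true)
                                (trans (∂-at-two Z x y u∈fs t∈fs u≢t u∋xy t∋xy) (cong₂ _xor_ Zu Zt))

  ∂-at-boundary-edge : ∀ {x y} → BoundaryEdge fs x y →
                       ∃ λ s → s ∈ fs × hasEdge s x y ≡ true × (∀ Z → ∂ Z x y ≡ Z s)
  ∂-at-boundary-edge {x} {y} xy-boundary with boundary-edge-triple xy-boundary
  ... | s , s∈fs , s∋xy , only-s = s , s∈fs , s∋xy , λ Z →
    trans (parity-single fs distinct s∈fs λ u u∈fs u≢s →
             trans (cong (Z u ∧_) (¬-not (u≢s ∘ only-s u u∈fs))) (∧-zeroʳ (Z u)))
          (trans (cong (Z s ∧_) s∋xy) (∧-identityʳ (Z s)))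

  ContainsStar : Chain₂ n → Fin n → Set
  ContainsStar Z v = ∀ t → t ∈ fs → v ∈ᵥ t ≡ true → Z t ≡ true

  Avoids : Chain₁ n → Fin n → Set
  Avoids z v = ∀ y → z v y ≡ false

  flood : ∀ Z v {t} → Avoids (∂ Z) v → t ∈ fs → v ∈ᵥ t ≡ true → Z t ≡ true → ContainsStar Z v
  flood Z v {t} ∂Z-avoids-v t∈fs v∈t Zt t′ t′∈fs v∈t′ =
    let x , t∋vx = some-edge-at v t∈fs v∈t
        y , t′∋vy = some-edge-at v t′∈fs v∈t′
        s , s∈fs , Zs , s∋vy =
          along-link (linkConn v x y (triple⇒edge t∈fs t∋vx) (triple⇒edge t′∈fs t′∋vy)) (t , t∈fs , Zt , t∋vx)
    in trans (sym (∂-false-propagates Z v y (∂Z-avoids-v y) s∈fs t′∈fs s∋vy t′∋vy)) Zs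
    where
      CoveredEdge : Fin n → Set
      CoveredEdge a = ∃ λ s → s ∈ fs × Z s ≡ true × hasEdge s v a ≡ true
      along-link : ∀ {a b} → Star (Face fs v) a b → CoveredEdge a → CoveredEdge b
      along-link ε covered = covered
      along-link {a} (f ◅ path) (s , s∈fs , Zs , s∋va) =
        let s′ , s′∈fs , _ , s′∋va , s′∋vc = face⇒hasEdge f
            Zs′ = trans (sym (∂-false-propagates Z v a (∂Z-avoids-v a) s∈fs s′∈fs s∋va s′∋va)) Zs
        in along-link path (s′ , s′∈fs , Zs′ , s′∋vc)

  ∂-kernel-trivial : ∀ Z → (∀ x y → ∂ Z x y ≡ false) → ∀ t → t ∈ fs → Z t ≡ false
  ∂-kernel-trivial Z ∂Z≡0 t@(p , _ , _) t∈fs = ¬-not λ Zt →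
    let bx , by , bxy-boundary = boundary
        s , s∈fs , s∋bxy , ∂Z≡Zs = ∂-at-boundary-edge bxy-boundary
        bx∈s , _ = hasEdge⇒ {t = s} {x = bx} s∋bxy
        star-p = flood Z p (∂Z≡0 p) t∈fs (∈₃⇒∈ᵥ t (inj₁ refl)) Zt
    in true≢false (trans (sym (along (connected p bx) star-p s s∈fs bx∈s))
                         (trans (sym (∂Z≡Zs Z)) (∂Z≡0 bx by)))
    where
      along : ∀ {a b} → Star (Edge fs) a b → ContainsStar Z a → ContainsStar Z b
      along ε star-a = star-a
      along {a} (_◅_ {j = c} ac-edge path) star-a =
        let s , s∈fs , s∋ac = edge⇒triple ac-edge
            a∈s , c∈s , _ = hasEdge⇒ {t = s} {x = a} {y = c} s∋ac
        in along path (flood Z c (∂Z≡0 c) s∈fs c∈s (star-a s s∈fs a∈s))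

  ∂-injective : ∀ Z Z′ → (∀ x y → ∂ Z x y ≡ ∂ Z′ x y) → ∀ t → t ∈ fs → Z t ≡ Z′ t
  ∂-injective Z Z′ ∂Z≗∂Z′ t t∈fs =
    xor≡false⇒≡ (∂-kernel-trivial (λ u → Z u xor Z′ u) ∂≡0 t t∈fs)
    where
      ∂≡0 : ∀ x y → ∂ (λ u → Z u xor Z′ u) x y ≡ false
      ∂≡0 x y = trans (∂-xor Z Z′ x y) (trans (cong (_xor ∂ Z′ x y) (∂Z≗∂Z′ x y)) (xor-same (∂ Z′ x y)))

  star-internal : ∀ Z v → Avoids (∂ Z) v → ContainsStar Z v → InternalVertex fs v
  star-internal Z v ∂Z-avoids-v star (e , ve-boundary) =
    let s , s∈fs , s∋ve , ∂≡Zs = ∂-at-boundary-edge ve-boundary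
        v∈s , _ = hasEdge⇒ {t = s} {x = v} {y = e} s∋ve
    in true≢false (trans (sym (star s s∈fs v∈s)) (trans (sym (∂≡Zs Z)) (∂Z-avoids-v e)))

  -- Every 1-cycle of a disk is a boundary

  #faces : Chain₂ n → ℕ
  #faces F = count F fs

  #vertices : (Fin n → Bool) → ℕ
  #vertices V = count V (allFin n)

  Path : Chain₁ n → Fin n → Fin n → Set
  Path E = Star (λ a b → E a b ≡ true)

  record Subcomplex : Set where
    field
      faces           : Chain₂ n
      edges           : Chain₁ n
      vertices        : Fin n → Bool
      face-edges      : ∀ t → t ∈ fs → faces t ≡ true → ∀ x y → hasEdge t x y ≡ true → edges x y ≡ true
      edge-vertex     : ∀ x y → edges x y ≡ true → vertices x ≡ true
      edges-sym       : ∀ x y → edges x y ≡ edges y x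
      edges-irrefl    : ∀ x → edges x x ≡ false
      graph-connected : ∀ x y → vertices x ≡ true → vertices y ≡ true → Path edges x y
      euler≤          : #edges edges + 1 ≤ #vertices vertices + #faces faces

  open Subcomplex

  size : Subcomplex → ℕ
  size K = #faces (faces K) + #vertices (vertices K)

  whole : Subcomplex
  whole = record
    { faces           = λ _ → true
    ; edges           = λ x y → does (edge? x y)
    ; vertices        = λ _ → true
    ; face-edges      = λ t t∈fs _ x y t∋xy → dec-true (edge? x y) (triple⇒edge t∈fs t∋xy)
    ; edge-vertex     = λ _ _ _ → refl
    ; edges-sym       = λ x y → does-⇔ (mk⇔ edge-sym edge-sym) (edge? x y) (edge? y x)
    ; edges-irrefl    = λ x → dec-false (edge? x x) (λ xx-edge → edge⇒≢ xx-edge refl)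
    ; graph-connected = λ x y _ _ → Star.map (λ {a} {b} → dec-true (edge? a b)) (connected x y)
    ; euler≤          = ℕ.≤-reflexive (begin
        #edges (λ x y → does (edge? x y)) + 1
          ≡⟨ cong (_+ 1) (length-filter≡count (λ (x , y) → x Fin.<? y ×-dec edge? x y) pairs) ⟨
        length (edgeList fs) + 1
          ≡⟨ ℕ.+-comm _ 1 ⟩
        1 + length (edgeList fs)
          ≡⟨ euler ⟨
        n + length fs
          ≡⟨ cong₂ _+_ (trans (count-true (allFin n)) (length-tabulate id)) (count-true fs) ⟨
        #vertices (λ _ → true) + #faces (λ _ → true)
          ∎)
    }
    where open ≡-Reasoning

  _∖ₜ_ : Chain₂ n → Triple n → Chain₂ n
  (F ∖ₜ t) u = F u ∧ not (u ==ₜ t)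

  ∖ₜ-⊆ : ∀ F t u → (F ∖ₜ t) u ≡ true → F u ≡ true × u ≢ t
  ∖ₜ-⊆ F t u F′u with F u
  ... | true = refl , λ u≡t → true≢false (trans (sym F′u) (cong not (dec-true (u ≟ₜ t) u≡t)))

  #faces-∖ₜ : ∀ F {t} → t ∈ fs → F t ≡ true → #faces F ≡ suc (#faces (F ∖ₜ t))
  #faces-∖ₜ F {t} t∈fs Ft = count-suc-at fs distinct t∈fs Ft removed kept
    where
      removed : (F ∖ₜ t) t ≡ false
      removed = trans (cong (λ v → F t ∧ not v) (dec-true (t ≟ₜ t) refl)) (∧-zeroʳ (F t))
      kept : ∀ u → u ∈ fs → u ≢ t → F u ≡ (F ∖ₜ t) u
      kept u _ u≢t = sym (trans (cong (λ v → F u ∧ not v) (dec-false (u ≟ₜ t) u≢t)) (∧-identityʳ (F u)))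

  _∖ᵥ_ : (Fin n → Bool) → Fin n → Fin n → Bool
  (V ∖ᵥ l) a = V a ∧ not (a == l)

  ∖ᵥ-⊆ : ∀ V l a → (V ∖ᵥ l) a ≡ true → V a ≡ true × a ≢ l
  ∖ᵥ-⊆ V l a V′a with V a | a ≟ l
  ... | true | no a≢l = refl , a≢l

  #vertices-∖ᵥ : ∀ V {l} → V l ≡ true → #vertices V ≡ suc (#vertices (V ∖ᵥ l))
  #vertices-∖ᵥ V {l} Vl = count-suc-at (allFin n) (allFin⁺ n) (∈-allFin l) Vl removed kept
    where
      removed : (V ∖ᵥ l) l ≡ false
      removed rewrite ==-refl l = ∧-zeroʳ (V l)
      kept : ∀ a → a ∈ allFin n → a ≢ l → V a ≡ (V ∖ᵥ l) a
      kept a _ a≢l rewrite ==-≢ a≢l = sym (∧-identityʳ (V a))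

  collapse : ∀ K {t x y} → FreeEdge (faces K) t x y → Subcomplex
  collapse K {t} {x} {y} (free-edge t∈fs Kt t∋xy only-t) = record
    { faces           = faces K ∖ₜ t
    ; edges           = E′
    ; vertices        = vertices K
    ; face-edges      = face-edges′
    ; edge-vertex     = λ a b E′ab → edge-vertex K a b (proj₁ (∖ₑ-⊆ (edges K) (x , y) a b E′ab))
    ; edges-sym       = E′-sym
    ; edges-irrefl    = λ a → cong (λ v → v ∧ not (does ((a , a) ≅ₑ? (x , y)))) (edges-irrefl K a)
    ; graph-connected = λ a b Va Vb → graph-connected K a b Va Vb Star.>>= detour
    ; euler≤          = ℕ.≤-pred euler≤′
    }
    where
      E′ = edges K ∖ₑ (x , y)
      E′-sym = ∖ₑ-sym (edges K) (x , y) (edges-sym K)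
      x≢y = proj₂ (proj₂ (hasEdge⇒ {t = t} {x = x} {y = y} t∋xy))

      face-edges′ : ∀ u → u ∈ fs → (faces K ∖ₜ t) u ≡ true →
                    ∀ a b → hasEdge u a b ≡ true → E′ a b ≡ true
      face-edges′ u u∈fs K′u a b u∋ab =
        let Ku , u≢t = ∖ₜ-⊆ (faces K) t u K′u in
        ∖ₑ-kept (edges K) (face-edges K u u∈fs Ku a b u∋ab) λ where
          (inj₁ (refl , refl)) → u≢t (only-t u u∈fs Ku u∋ab)
          (inj₂ (refl , refl)) → u≢t (only-t u u∈fs Ku (trans (hasEdge-sym u x y) u∋ab))

      x⇝y : Path E′ x y
      x⇝y with third-vertex x y t∈fs t∋xy
      ... | w , t∋xw , t∋wy , w≢x , w≢y =
        ∖ₑ-kept (edges K) (face-edges K t t∈fs Kt x w t∋xw) [ w≢y ∘ proj₂ , x≢y ∘ proj₁ ]′ ◅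
        ∖ₑ-kept (edges K) (face-edges K t t∈fs Kt w y t∋wy) [ w≢x ∘ proj₁ , w≢y ∘ proj₁ ]′ ◅ ε

      detour : ∀ {a b} → edges K a b ≡ true → Path E′ a b
      detour {a} {b} Eab with (a , b) ≅ₑ? (x , y)
      ... | no ab≇xy                 = ∖ₑ-kept (edges K) Eab ab≇xy ◅ ε
      ... | yes (inj₁ (refl , refl)) = x⇝y
      ... | yes (inj₂ (refl , refl)) = Star.reverse (λ {a} {b} E′ab → trans (E′-sym b a) E′ab) x⇝y

      euler≤′ : suc (#edges E′ + 1) ≤ suc (#vertices (vertices K) + #faces (faces K ∖ₜ t))
      euler≤′ = begin
        suc (#edges E′) + 1
          ≡⟨ cong (_+ 1) (#edges-∖ₑ (edges K) (edges-sym K) x≢y (face-edges K t t∈fs Kt x y t∋xy)) ⟨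
        #edges (edges K) + 1
          ≤⟨ euler≤ K ⟩
        #vertices (vertices K) + #faces (faces K)
          ≡⟨ cong (#vertices (vertices K) +_) (#faces-∖ₜ (faces K) t∈fs Kt) ⟩
        #vertices (vertices K) + suc (#faces (faces K ∖ₜ t))
          ≡⟨ ℕ.+-suc _ _ ⟩
        suc (#vertices (vertices K) + #faces (faces K ∖ₜ t))
          ∎
        where open ℕ.≤-Reasoning

  Leaf : Subcomplex → Fin n → Fin n → Set
  Leaf K l u = edges K l u ≡ true × (∀ c → edges K l c ≡ true → c ≡ u)

  leaf? : ∀ K → Dec (∃ λ l → ∃ λ u → Leaf K l u)
  leaf? K = any? λ l → any? λ u →
    (edges K l u ≟ᵇ true) ×-dec all? (λ c → (edges K l c ≟ᵇ true) →-dec (c ≟ u))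

  prune : ∀ K → (∀ t → t ∈ fs → faces K t ≡ false) → ∀ {l u} → Leaf K l u → Subcomplex
  prune K no-faces {l} {u} (Elu , only-u) = record
    { faces           = faces K
    ; edges           = E′
    ; vertices        = vertices K ∖ᵥ l
    ; face-edges      = λ t t∈fs Kt → ⊥-elim (true≢false (trans (sym Kt) (no-faces t t∈fs)))
    ; edge-vertex     = edge-vertex′
    ; edges-sym       = ∖ₑ-sym (edges K) (l , u) (edges-sym K)
    ; edges-irrefl    = λ a → cong (λ v → v ∧ not (does ((a , a) ≅ₑ? (l , u)))) (edges-irrefl K a)
    ; graph-connected = λ a b V′a V′b →
        let Va , a≢l = ∖ᵥ-⊆ (vertices K) l a V′a
            Vb , b≢l = ∖ᵥ-⊆ (vertices K) l b V′b
        in proj₁ (bypass (graph-connected K a b Va Vb) b≢l) a≢l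
    ; euler≤          = ℕ.≤-pred euler≤′
    }
    where
      E′ = edges K ∖ₑ (l , u)

      u≢l : u ≢ l
      u≢l refl = true≢false (trans (sym Elu) (edges-irrefl K u))

      edge-vertex′ : ∀ a b → E′ a b ≡ true → (vertices K ∖ᵥ l) a ≡ true
      edge-vertex′ a b E′ab with ∖ₑ-⊆ (edges K) (l , u) a b E′ab | a ≟ l
      ... | Eab , ab≇lu | yes refl = ⊥-elim (ab≇lu (inj₁ (refl , only-u b Eab)))
      ... | Eab , _     | no _     = trans (∧-identityʳ _) (edge-vertex K a b Eab)

      bypass : ∀ {a b} → Path (edges K) a b → b ≢ l → (a ≢ l → Path E′ a b) × (a ≡ l → Path E′ u b)
      bypass ε b≢l = (λ _ → ε) , (λ a≡l → ⊥-elim (b≢l a≡l))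
      bypass {a} (_◅_ {j = c} Eac path) b≢l = from-a , from-l
        where
          from-c = proj₁ (bypass path b≢l)
          from-a : a ≢ l → Path E′ a _
          from-a a≢l with c ≟ l
          ... | yes refl = subst (λ v → Path E′ v _) (sym (only-u a (trans (edges-sym K l a) Eac)))
                                 (proj₂ (bypass path b≢l) refl)
          ... | no c≢l   = ∖ₑ-kept (edges K) Eac [ a≢l ∘ proj₁ , c≢l ∘ proj₂ ]′ ◅ from-c c≢l
          from-l : a ≡ l → Path E′ u _
          from-l refl = subst (λ v → Path E′ v _) (only-u c Eac) (from-c (subst (_≢ l) (sym (only-u c Eac)) u≢l))

      euler≤′ : suc (#edges E′ + 1) ≤ suc (#vertices (vertices K ∖ᵥ l) + #faces (faces K))
      euler≤′ = begin
        suc (#edges E′) + 1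
          ≡⟨ cong (_+ 1) (#edges-∖ₑ (edges K) (edges-sym K) (≢-sym u≢l) Elu) ⟨
        #edges (edges K) + 1
          ≤⟨ euler≤ K ⟩
        #vertices (vertices K) + #faces (faces K)
          ≡⟨ cong (_+ #faces (faces K)) (#vertices-∖ᵥ (vertices K) (edge-vertex K l u Elu)) ⟩
        suc (#vertices (vertices K ∖ᵥ l)) + #faces (faces K)
          ∎
        where open ℕ.≤-Reasoning

  edgeless : ∀ K → (∀ t → t ∈ fs → faces K t ≡ false) → (∀ l u → ¬ Leaf K l u) →
             ∀ x y → edges K x y ≡ false
  edgeless K no-faces no-leaf x₀ y₀ = ¬-not λ Ex₀y₀ → ℕ.<-irrefl refl (begin-strict
    #edges E + #edges E              <⟨ ℕ.+-mono-< (ℕ.m<m+n (#edges E) (s≤s z≤n)) (ℕ.m<m+n (#edges E) (s≤s z≤n)) ⟩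
    (#edges E + 1) + (#edges E + 1)  ≤⟨ ℕ.+-mono-≤ E+1≤V E+1≤V ⟩
    #vertices V + #vertices V        ≤⟨ count+count≤sumOver (allFin n) (degree≥2 Ex₀y₀) ⟩
    sumOver (degree E) (allFin n)    ≡⟨ handshake E (edges-sym K) (edges-irrefl K) ⟩
    #edges E + #edges E              ∎)
    where
      open ℕ.≤-Reasoning
      E = edges K
      V = vertices K
      E+1≤V : #edges E + 1 ≤ #vertices V
      E+1≤V = subst (#edges E + 1 ≤_) (trans (cong (#vertices V +_) (count-zero fs no-faces)) (ℕ.+-identityʳ _))
                    (euler≤ K)
      neighbour : E x₀ y₀ ≡ true → ∀ v → V v ≡ true → ∃ λ w → E v w ≡ true
      neighbour Ex₀y₀ v Vv with graph-connected K v x₀ Vv (edge-vertex K x₀ y₀ Ex₀y₀)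
      ... | ε       = y₀ , Ex₀y₀
      ... | Evw ◅ _ = _ , Evw
      degree≥2 : E x₀ y₀ ≡ true → ∀ v → V v ≡ true → 2 ≤ degree E v
      degree≥2 Ex₀y₀ v Vv with neighbour Ex₀y₀ v Vv
      ... | w , Evw
        with ¬∀⟶∃¬ n _ (λ c → (E v c ≟ᵇ true) →-dec (c ≟ w)) (λ only-w → no-leaf v w (Evw , only-w))
      ... | c , ¬[Evc⇒c≡w] with E v c in Evc
      ... | false = ⊥-elim (¬[Evc⇒c≡w] λ ())
      ... | true  = 2≤count (allFin n) (allFin⁺ n) (∈-allFin w) (∈-allFin c)
                            (λ w≡c → ¬[Evc⇒c≡w] λ _ → sym w≡c) Evw Evc

  IsBoundary : Chain₁ n → Set
  IsBoundary z = ∃ λ R → ∀ x y → ∂ R x y ≡ z x y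

  isBoundary-collapse : ∀ K {t x y} (free : FreeEdge (faces K) t x y) {z} → IsCycle z → z ⊆ₑ edges K →
    (∀ {z′} → IsCycle z′ → z′ ⊆ₑ edges (collapse K free) → IsBoundary z′) → IsBoundary z
  isBoundary-collapse K {t} {x} {y} free@(free-edge t∈fs Kt t∋xy _) {z} z-cyc z⊆K bounds′ =
    let R′ , ∂R′≗z′ = bounds′ z′-cyc z′⊆K′ in
    (λ u → R′ u xor (z x y ∧ (u ==ₜ t))) , λ a b → begin
      ∂ (λ u → R′ u xor (z x y ∧ (u ==ₜ t))) a b
        ≡⟨ ∂-xor R′ _ a b ⟩
      ∂ R′ a b xor ∂ (λ u → z x y ∧ (u ==ₜ t)) a b
        ≡⟨ cong₂ _xor_ (∂R′≗z′ a b) (∂-singleton distinct t∈fs (z x y) a b) ⟩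
      (z a b xor (z x y ∧ hasEdge t a b)) xor (z x y ∧ hasEdge t a b)
        ≡⟨ xor-cancelʳ (z a b) (z x y ∧ hasEdge t a b) ⟩
      z a b
        ∎
    where
      open ≡-Reasoning
      xor-cancelʳ : ∀ p q → (p xor q) xor q ≡ p
      xor-cancelʳ p q = trans (xor-assoc p q q) (trans (cong (p xor_) (xor-same q)) (xor-identityʳ p))

      z′ : Chain₁ n
      z′ a b = z a b xor (z x y ∧ hasEdge t a b)

      z′-cyc : IsCycle z′
      z′-cyc = isCycle-xor z-cyc (isCycle-∧ˡ (z x y) (triangle-isCycle (sorted⇒distinct (sorted∈ t∈fs))))

      z′xy≡false : z′ x y ≡ false
      z′xy≡false = trans (cong (λ v → z x y xor (z x y ∧ v)) t∋xy)
                         (trans (cong (z x y xor_) (∧-identityʳ (z x y))) (xor-same (z x y)))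

      z′⊆K : z′ ⊆ₑ edges K
      z′⊆K a b z′ab with z a b in zab
      ... | true  = z⊆K a b zab
      ... | false = face-edges K t t∈fs Kt a b (proj₂ (∧≡true (z x y) z′ab))

      z′⊆K′ : z′ ⊆ₑ edges (collapse K free)
      z′⊆K′ a b z′ab = ∖ₑ-kept (edges K) (z′⊆K a b z′ab) λ where
        (inj₁ (refl , refl)) → true≢false (trans (sym z′ab) z′xy≡false)
        (inj₂ (refl , refl)) → true≢false (trans (sym z′ab) (trans (z′-cyc .symmetric y x) z′xy≡false))

  isBoundary-prune : ∀ K no-faces {l u} (leaf : Leaf K l u) {z} → IsCycle z → z ⊆ₑ edges K →
    (IsCycle z → z ⊆ₑ edges (prune K no-faces leaf) → IsBoundary z) → IsBoundary z
  isBoundary-prune K no-faces {l} {u} (Elu , only-u) {z} z-cyc z⊆K bounds′ =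
    bounds′ z-cyc λ a b zab → ∖ₑ-kept (edges K) (z⊆K a b zab) λ where
      (inj₁ (refl , refl)) → true≢false (trans (sym zab) zlu≡false)
      (inj₂ (refl , refl)) → true≢false (trans (sym zab) (trans (z-cyc .symmetric u l) zlu≡false))
    where
      zlu≡false : z l u ≡ false
      zlu≡false = cycle-pendant-edge z-cyc (λ c zlc → only-u c (z⊆K l c zlc))

  cycle-isBoundary-in : ∀ K → Acc _<_ (size K) → ∀ {z} → IsCycle z → z ⊆ₑ edges K → IsBoundary z
  cycle-isBoundary-in K (acc smaller) z-cyc z⊆K with any? (λ x → any? (λ y → ∂ (faces K) x y ≟ᵇ true))
  ... | yes (x , y , ∂Kxy) =
    let _ , free = ∂-true⇒free-edge (faces K) x y ∂Kxy
        shrinks = ℕ.≤-reflexive (cong (_+ #vertices (vertices K))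
                                      (sym (#faces-∖ₜ (faces K) (face∈fs free) (face∈Z free))))
    in isBoundary-collapse K free z-cyc z⊆K (cycle-isBoundary-in (collapse K free) (smaller shrinks))
  ... | no no-free with leaf? K | ∂-kernel-trivial (faces K) (λ x y → ¬-not λ ∂Kxy → no-free (x , y , ∂Kxy))
  ...   | yes (_ , _ , leaf) | no-faces =
    let shrinks = ℕ.≤-reflexive (trans (sym (ℕ.+-suc _ _)) (cong (#faces (faces K) +_)
                    (sym (#vertices-∖ᵥ (vertices K) (edge-vertex K _ _ (proj₁ leaf))))))
    in isBoundary-prune K no-faces leaf z-cyc z⊆K (cycle-isBoundary-in (prune K no-faces leaf) (smaller shrinks))
  ...   | no no-leaf | no-faces = (λ _ → false) , λ x y →
    trans (parity-false fs (λ _ _ → refl)) (sym (¬-not λ zxy → true≢false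
      (trans (sym (z⊆K x y zxy)) (edgeless K no-faces (λ l u leaf → no-leaf (l , u , leaf)) x y))))

  cycle-isBoundary : ∀ {z} → IsCycle z → (∀ x y → z x y ≡ true → Edge fs x y) → IsBoundary z
  cycle-isBoundary z-cyc z⊆edges =
    cycle-isBoundary-in whole (<-wellFounded _) z-cyc λ x y zxy → dec-true (edge? x y) (z⊆edges x y zxy)

  -- Missing triangles

  _Bounds_ : Chain₂ n → Triple n → Set
  R Bounds t = ∀ x y → ∂ R x y ≡ hasEdge t x y

  missing-distinct : ∀ {a b c} → MissingTriangle fs a b c → a ≢ b × a ≢ c × b ≢ c
  missing-distinct (ab , ac , bc , _) = edge⇒≢ ab , edge⇒≢ ac , edge⇒≢ bc

  missing-edges : ∀ {a b c} → MissingTriangle fs a b c → ∀ x y → hasEdge (a , b , c) x y ≡ true → Edge fs x y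
  missing-edges {a} {b} {c} (ab , ac , bc , _) x y abc∋xy
    with hasEdge-cases {a = a} {b = b} {c = c} {x = x} {y = y} abc∋xy
  ... | inj₁ (refl , refl)                             = ab
  ... | inj₂ (inj₁ (refl , refl))                      = edge-sym ab
  ... | inj₂ (inj₂ (inj₁ (refl , refl)))               = ac
  ... | inj₂ (inj₂ (inj₂ (inj₁ (refl , refl))))        = edge-sym ac
  ... | inj₂ (inj₂ (inj₂ (inj₂ (inj₁ (refl , refl))))) = bc
  ... | inj₂ (inj₂ (inj₂ (inj₂ (inj₂ (refl , refl))))) = edge-sym bc

  missing-isBoundary : ∀ {a b c} → MissingTriangle fs a b c → ∃ λ R → R Bounds (a , b , c)
  missing-isBoundary abc = cycle-isBoundary (triangle-isCycle (missing-distinct abc)) (missing-edges abc)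

  missing? : ∀ a b c → Dec (MissingTriangle fs a b c)
  missing? a b c = edge? a b ×-dec edge? a c ×-dec edge? b c ×-dec ¬? (face? fs a b c)

  contractible-or-missing : ∀ {a b} → Edge fs a b → Contractible fs a b ⊎ ∃ (MissingTriangle fs a b)
  contractible-or-missing {a} {b} ab with all? (λ c → ¬? (missing? a b c))
  ... | yes none = inj₁ (ab , none)
  ... | no some with ¬∀⟶∃¬ n _ (λ c → ¬? (missing? a b c)) some
  ...   | c , ¬¬abc = inj₂ (c , decidable-stable (missing? a b c) ¬¬abc)

  -- The chain Q = R′ ∖ R has its boundary on the triangle abc: off abc it agrees
  -- with ∂R′, which avoids d, leaving only the edge ae, which would be pendant at e.
  -- So ∂Q is 0 (then R′ ⊆ R) or ∂R (then Q = R, impossible since Q misses R ≠ 0).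
  module _ {a b c d e R R′} (abc : MissingTriangle fs a b c) (ade : MissingTriangle fs a d e)
           (R-bounds : R Bounds (a , b , c)) (R′-bounds : R′ Bounds (a , d , e)) (star-d : ContainsStar R d)
           where

    private
      Q : Chain₂ n
      Q u = R′ u ∧ not (R u)

      Q≗R′-off-R : ∀ x y s → (hasEdge s x y ≡ true → R s ≡ false) →
                   Q s ∧ hasEdge s x y ≡ R′ s ∧ hasEdge s x y
      Q≗R′-off-R x y s R-off with hasEdge s x y in s∋xy
      ... | false = trans (∧-zeroʳ (Q s)) (sym (∧-zeroʳ (R′ s)))
      ... | true  = cong (_∧ true) (trans (cong (λ r → R′ s ∧ not r) (R-off refl)) (∧-identityʳ (R′ s)))

      ∂Q-off-abc : ∀ x y → ∂ Q x y ≡ true → hasEdge (a , b , c) x y ≡ false →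
                   ∃ λ u → u ∈ fs × R u ≡ false × hasEdge u x y ≡ true × hasEdge (a , d , e) x y ≡ true
      ∂Q-off-abc x y ∂Qxy abc∌xy =
        let u , u∈fs , Qu∧u∋xy = parity-true fs ∂Qxy
            Qu , u∋xy = ∧≡true (Q u) Qu∧u∋xy
            Ru≡false = not≡true (proj₂ (∧≡true (R′ u) Qu))
            R-off-xy : ∀ {s} → s ∈ fs → hasEdge s x y ≡ true → R s ≡ false
            R-off-xy s∈fs s∋xy =
              trans (sym (∂-false-propagates R x y (trans (R-bounds x y) abc∌xy) u∈fs s∈fs u∋xy s∋xy)) Ru≡false
            ∂Q≡∂R′ = parity-cong fs (λ s s∈fs → Q≗R′-off-R x y s (R-off-xy s∈fs))
        in u , u∈fs , Ru≡false , u∋xy , trans (sym (R′-bounds x y)) (trans (sym ∂Q≡∂R′) ∂Qxy)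

      outside-star : ∀ {u v} → u ∈ fs → R u ≡ false → v ∈ᵥ u ≡ true → v ≢ d
      outside-star {u} u∈fs Ru≡false v∈u refl = true≢false (trans (sym (star-d u u∈fs v∈u)) Ru≡false)

      off-abc : ∀ x y → ∂ Q x y ≡ true → hasEdge (a , b , c) x y ≡ false → (x ≡ a × y ≡ e) ⊎ (x ≡ e × y ≡ a)
      off-abc x y ∂Qxy abc∌xy with ∂Q-off-abc x y ∂Qxy abc∌xy
      ... | u , u∈fs , Ru≡false , u∋xy , ade∋xy
        with hasEdge⇒ {t = u} {x = x} {y = y} u∋xy | hasEdge-cases {a = a} {b = d} {c = e} {x = x} {y = y} ade∋xy
      ... | _ , y∈u , _ | inj₁ (_ , y≡d)                             = ⊥-elim (outside-star u∈fs Ru≡false y∈u y≡d)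
      ... | x∈u , _ , _ | inj₂ (inj₁ (x≡d , _))                      = ⊥-elim (outside-star u∈fs Ru≡false x∈u x≡d)
      ... | _ , _ , _   | inj₂ (inj₂ (inj₁ ae))                      = inj₁ ae
      ... | _ , _ , _   | inj₂ (inj₂ (inj₂ (inj₁ ea)))               = inj₂ ea
      ... | x∈u , _ , _ | inj₂ (inj₂ (inj₂ (inj₂ (inj₁ (x≡d , _))))) = ⊥-elim (outside-star u∈fs Ru≡false x∈u x≡d)
      ... | _ , y∈u , _ | inj₂ (inj₂ (inj₂ (inj₂ (inj₂ (_ , y≡d))))) = ⊥-elim (outside-star u∈fs Ru≡false y∈u y≡d)

      ∂Q⊆abc : ∂ Q ⊆ₑ hasEdge (a , b , c)
      ∂Q⊆abc x y ∂Qxy with hasEdge (a , b , c) x y in abc∋xy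
      ... | true  = refl
      ... | false = ⊥-elim (true≢false (trans (sym ∂Qae) (trans (∂-isCycle Q .symmetric a e) ∂Qea≡false)))
        where
          a≢e = proj₁ (proj₂ (missing-distinct ade))
          ∂Qae : ∂ Q a e ≡ true
          ∂Qae with off-abc x y ∂Qxy abc∋xy
          ... | inj₁ (refl , refl) = ∂Qxy
          ... | inj₂ (refl , refl) = trans (∂-isCycle Q .symmetric a e) ∂Qxy
          abc∌ae : hasEdge (a , b , c) a e ≡ false
          abc∌ae with off-abc x y ∂Qxy abc∋xy
          ... | inj₁ (refl , refl) = abc∋xy
          ... | inj₂ (refl , refl) = trans (hasEdge-sym (a , b , c) a e) abc∋xy
          e∉abc : e ∈ᵥ (a , b , c) ≡ false
          e∉abc = ¬-not λ e∈abc → true≢false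
            (trans (sym (hasEdge⇐ {t = a , b , c} (∈₃⇒∈ᵥ (a , b , c) (inj₁ refl)) e∈abc a≢e)) abc∌ae)
          ∂Qea≡false : ∂ Q e a ≡ false
          ∂Qea≡false = cycle-pendant-edge {v = e} {u = a} (∂-isCycle Q) λ w ∂Qew →
            case off-abc e w ∂Qew (hasEdge-∉ᵥ {t = a , b , c} {v = e} w e∉abc) of λ where
              (inj₁ (e≡a , _)) → ⊥-elim (a≢e (sym e≡a))
              (inj₂ (_ , w≡a)) → w≡a

      ∂Q-multiple : ∀ x y → ∂ Q x y ≡ ∂ Q a b ∧ hasEdge (a , b , c) x y
      ∂Q-multiple = cycle-on-triangle (∂-isCycle Q) (missing-distinct abc) ∂Q⊆abc

    nested : ∀ t → t ∈ fs → R′ t ≡ true → R t ≡ true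
    nested t t∈fs R′t with ∂ Q a b in ∂Qab
    ... | false = ¬-not λ Rt≡false →
      true≢false (trans (sym (cong₂ (λ p q → p ∧ not q) R′t Rt≡false)) (Q-empty t t∈fs))
      where
        Q-empty : ∀ u → u ∈ fs → Q u ≡ false
        Q-empty = ∂-kernel-trivial Q λ x y → trans (∂Q-multiple x y) (cong (_∧ hasEdge (a , b , c) x y) ∂Qab)
    ... | true  with ∂-true⇒free-edge R a b (trans (R-bounds a b) (first-edge (missing-distinct abc)))
    ...   | t₀ , free-edge t₀∈fs Rt₀ _ _ = ⊥-elim (true≢false (begin
      true                 ≡⟨ Rt₀ ⟨
      R t₀                 ≡⟨ Q≗R t₀ t₀∈fs ⟨
      R′ t₀ ∧ not (R t₀)   ≡⟨ cong (λ r → R′ t₀ ∧ not r) Rt₀ ⟩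
      R′ t₀ ∧ false        ≡⟨ ∧-zeroʳ (R′ t₀) ⟩
      false                ∎))
      where
        open ≡-Reasoning
        Q≗R : ∀ u → u ∈ fs → Q u ≡ R u
        Q≗R = ∂-injective Q R λ x y →
          trans (∂Q-multiple x y) (trans (cong (_∧ hasEdge (a , b , c) x y) ∂Qab) (sym (R-bounds x y)))

  apex : ∀ {a b c R} → MissingTriangle fs a b c → R Bounds (a , b , c) →
         ∃ λ d → Edge fs a d × Avoids (∂ R) d × ContainsStar R d
  apex {a} {b} {c} {R} abc@(_ , _ , _ , ¬abc) R-bounds =
    let t , free-edge t∈fs Rt t∋ab _ = ∂-true⇒free-edge R a b (trans (R-bounds a b) (first-edge (missing-distinct abc)))
        d , abd , t≈abd = triple⇒face fs t∈fs t∋ab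
        a≢b , a≢d , b≢d = face-distinct abd
        a∈t = trans (t≈abd a) (∈₃⇒∈ᵥ (a , b , d) (inj₁ refl))
        d∈t = trans (t≈abd d) (∈₃⇒∈ᵥ (a , b , d) (inj₂ (inj₂ refl)))
        d∉abc : d ∈ᵥ (a , b , c) ≡ false
        d∉abc = ¬-not λ d∈abc → case ∈ᵥ⇒∈₃ {v = d} (a , b , c) d∈abc of λ where
          (inj₁ d≡a)        → a≢d (sym d≡a)
          (inj₂ (inj₁ d≡b)) → b≢d (sym d≡b)
          (inj₂ (inj₂ d≡c)) → ¬abc (subst (Face fs a b) d≡c abd)
        avoids-d : Avoids (∂ R) d
        avoids-d y = trans (R-bounds d y) (hasEdge-∉ᵥ {t = a , b , c} {v = d} y d∉abc)
    in d , triple⇒edge t∈fs (hasEdge⇐ {t = t} a∈t d∈t a≢d) , avoids-d , flood R d avoids-d t∈fs d∈t Rt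

  inner-smaller : ∀ {a b c d e R R′} → MissingTriangle fs a b c → MissingTriangle fs a d e →
                  R Bounds (a , b , c) → R′ Bounds (a , d , e) → Avoids (∂ R) d → ContainsStar R d →
                  count R′ fs < count R fs
  inner-smaller {a} {d = d} {e} {R} {R′} abc ade R-bounds R′-bounds avoids-d star-d
    with count-<-or-agree fs (nested abc ade R-bounds R′-bounds star-d)
  ... | inj₁ fewer = fewer
  ... | inj₂ R′≗R = ⊥-elim (true≢false (begin
    true                     ≡⟨ first-edge (missing-distinct ade) ⟨
    hasEdge (a , d , e) a d  ≡⟨ R′-bounds a d ⟨
    ∂ R′ a d                 ≡⟨ ∂-cong R′≗R a d ⟩
    ∂ R a d                  ≡⟨ ∂-isCycle R .symmetric a d ⟩
    ∂ R d a                  ≡⟨ avoids-d a ⟩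
    false                    ∎))
    where open ≡-Reasoning

  InternalContractibleEdge : Set
  InternalContractibleEdge =
    Σ (Fin n) λ a → Σ (Fin n) λ b → InternalVertex fs a × InternalVertex fs b × Contractible fs a b

  descend : ∀ {a b c} R → Acc _<_ (count R fs) → InternalVertex fs a → MissingTriangle fs a b c →
            R Bounds (a , b , c) → InternalContractibleEdge
  descend {a} R (acc smaller) a-internal abc R-bounds =
    let d , ad , avoids-d , star-d = apex abc R-bounds in
    case contractible-or-missing ad of λ where
      (inj₁ ad-contractible) → a , d , a-internal , star-internal R d avoids-d star-d , ad-contractible
      (inj₂ (e , ade)) →
        let R′ , R′-bounds = missing-isBoundary ade in
        descend R′ (smaller (inner-smaller abc ade R-bounds R′-bounds avoids-d star-d)) a-internal ade R′-bounds

  internal-edge⇒contractible : ∀ {a b} → InternalVertex fs a → InternalVertex fs b → Edge fs a b →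
                               InternalContractibleEdge
  internal-edge⇒contractible {a} {b} a-internal b-internal ab with contractible-or-missing ab
  ... | inj₁ ab-contractible = a , b , a-internal , b-internal , ab-contractible
  ... | inj₂ (c , abc) =
    let R , R-bounds = missing-isBoundary abc in descend R (<-wellFounded _) a-internal abc R-bounds

lemma4p10 : (n : ℕ) (fs : List (Triple n)) → TriangulatedDisk fs →
  InternallyConnected fs →
  Σ (Fin n) (λ u → Σ (Fin n) (λ w → InternalVertex fs u × InternalVertex fs w × u ≢ w)) →
  Σ (Fin n) (λ a → Σ (Fin n) (λ b → InternalVertex fs a × InternalVertex fs b × Contractible fs a b))
lemma4p10 n fs D internally-connected (u , w , u-internal , w-internal , u≢w)
  with internally-connected u w u-internal w-internal
... | ε                         = ⊥-elim (u≢w refl)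
... | (ux , _ , x-internal) ◅ _ = Disk.internal-edge⇒contractible D u-internal x-internal ux
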